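{- Let $t$ be a term with $\Gamma \vdash t : \tau$ for some context $\Gamma$ and type $\tau$, and let $N \in \mathbb{N}$ with $N \geq |\mathrm{FV}(t)|$, where $\mathrm{FV}(t)$ is the set of free variables of $t$. If $t \to t'$, then $$\pi(t)(N) + |t| \;>\; \pi(t')(N) + |t'|.$$ In particular, every reduction sequence $t = t_0 \to t_1 \to \cdots \to t_k$ starting from $t$ has length $k \leq \pi(t)(|\mathrm{FV}(t)|) + |t|$.
   Context: Linear types are generated by $\rho,\tau ::= \Diamond \mid \mathbf{B} \mid \tau\multimap\rho \mid \tau\otimes\rho \mid \tau\times\rho \mid \mathbf{L}(\tau)$. There are infinitely many variables of each type; $x^\tau$ denotes a variable $x$ of type $\tau$. Raw terms are $r,s,t ::= x^\tau \mid c \mid \lambda x^\tau.t \mid \langle t,s\rangle \mid t s \mid \{t\}$, where the constants $c$ are $\mathsf{tt},\mathsf{ff}$ of type $\mathbf B$, $\mathsf{nil}_\tau$ of type $\mathbf L(\tau)$, $\mathsf{cons}_\tau$ of type $\Diamond\multimap\tau\multimap\mathbf L(\tau)\multimap\mathbf L(\tau)$, and $\otimes_{\tau,\rho}$ of type $\tau\multimap\rho\multimap\tau\otimes\rho$ (for all types $\tau,\rho$). Application associates to the left, $\lambda x,y.t$ abbreviates $\lambda x.\lambda y.t$, $\alpha$-equivalent terms are identified, free variables are defined as usual, and $t[s/x]$ denotes capture-avoiding substitution ($t[s,r/x,y]$ simultaneous substitution). A context is a finite set of variables; $\Gamma_1,\Gamma_2$ denotes $\Gamma_1\cup\Gamma_2$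 where these are disjoint. The typing relation $\Gamma\vdash t:\tau$ is inductively defined by: (Var) $\Gamma,x^\tau\vdash x:\tau$; (Const) $\Gamma\vdash c:\tau$ if $c$ has type $\tau$; ($\multimap^+$) from $\Gamma\cup\{x^\tau\}\vdash t:\rho$ infer $\Gamma\vdash\lambda x^\tau.t:\tau\multimap\rho$; ($\multimap^-$) from $\Gamma_1\vdash t:\tau\multimap\rho$ and $\Gamma_2\vdash s:\tau$ infer $\Gamma_1,\Gamma_2\vdash ts:\rho$; ($\times^+$) from $\Gamma\vdash t:\tau$ and $\Gamma\vdash s:\rho$ infer $\Gamma\vdash\langle t,s\rangle:\tau\times\rho$; ($\times^-$) from $\Gamma\vdash t:\tau\times\rho$ infer $\Gamma\vdash t\,\mathsf{tt}:\tau$ and $\Gamma\vdash t\,\mathsf{ff}:\rho$; ($\mathbf B^-$) from $\Gamma_1\vdash t:\mathbf B$, $\Gamma_2\vdash s:\tau$, $\Gamma_2\vdash r:\tau$ infer $\Gamma_1,\Gamma_2\vdash t\langle s,r\rangle:\tau$; ($\otimes^-$) from $\Gamma_1\vdash t:\tau\otimes\rho$ and $\Gamma_2,x^\tau,y^\rho\vdash s:\sigma$ infer $\Gamma_1,\Gamma_2\vdash t(\lambda x^\tau,y^\rho.s):\sigma$; ($\mathbf L^-$) from $\Gamma\vdash t:\mathbf L(\tau)$ and $\emptyset\vdash s:\Diamond\multimap\tau\multimap\rho\multimap\rho$ infer $\Gamma\vdash t\{s\}:\rho\multimap\rho$. A list with $n$ entries is a term $\mathsf{cons}_\tau d_1 a_1(\cdots(\mathsf{cons}_\tau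 d_n a_n\,\mathsf{nil}_\tau))$ where the $d_i$ are terms typable with type $\Diamond$ and the $a_i$ terms typable with type $\tau$. Conversions $\mapsto$: $(\lambda x.t)s\mapsto t[s/x]$; $\langle t,s\rangle\mathsf{tt}\mapsto t$; $\langle t,s\rangle\mathsf{ff}\mapsto s$; $\mathsf{tt}\langle t,s\rangle\mapsto t$; $\mathsf{ff}\langle t,s\rangle\mapsto s$; $\otimes_{\tau,\rho}ts(\lambda x^\tau,y^\rho.r)\mapsto r[t,s/x,y]$; $\mathsf{nil}_\tau\{t\}s\mapsto s$; $\mathsf{cons}_\tau d a\ell\{t\}s\mapsto t d a(\ell\{t\}s)$ provided $\ell$ is a list. The reduction relation $\to$ is the least relation such that $t\mapsto t'$ implies $t\to t'$, $t\to t'$ implies $ts\to t's$, and $s\to s'$ implies $ts\to ts'$ (no reduction under $\lambda$, inside pairs, or inside braces). Length: $|c|=|x|=1$, $|ts|=|t|+|s|$, $|\lambda x.s|=|s|+1$, $|\langle t,s\rangle|=\max(|t|,|s|)+1$, $|\{t\}|=0$. Let $\mathbb N^{\mathrm{poly}}$ be the set of functions $\mathbb N\to\mathbb N$ bounded pointwise by a polynomial, with pointwise sum, product, maximum $\sup$ and order $\preccurlyeq$; naturals are constant functions, $X$ is the identity, and $X_n(m)=\min(n,m)$. The polynomial bound $\pi(t)\in\mathbb N^{\mathrm{poly}}$ is defined by recursion on terms: $\pi(x)=\pi(c)=0$; $\pi(ts)=\pi(t)+X_n\cdot\pi(h)+X_n\cdot|h|$ if $t$ is a list with $n$ entries and $s=\{h\}$,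 and $\pi(ts)=\pi(t)+\pi(s)$ otherwise; $\pi(\lambda x.t)=\pi(t)$; $\pi(\langle t,s\rangle)=\sup(\pi(t),\pi(s))$; $\pi(\{h\})=X\cdot\pi(h)+X\cdot|h|$. -}

module Defs where

open import Data.Nat using (ℕ; zero; suc; _+_; _*_; _⊔_; _⊓_; _≟_)
open import Data.Product using (Σ; ∃; ∃-syntax; _×_; _,_)
open import Data.List using (List; []; _∷_; _++_; length; deduplicate)
open import Data.List.Membership.Propositional using (_∈_; _∉_)
open import Data.Product.Properties using (≡-dec)
open import Relation.Nullary using (¬_; Dec; yes; no)
open import Relation.Binary.PropositionalEquality using (_≡_; refl; _≢_)

infixr 30 _⊸_
infixr 35 _⊗_ _×ₜ_

data Ty : Set where
  ◇    : Ty
  𝐁    : Ty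
  _⊸_  : Ty → Ty → Ty
  _⊗_  : Ty → Ty → Ty
  _×ₜ_ : Ty → Ty → Ty
  𝐋    : Ty → Ty

infix 4 _≟ₜ_
_≟ₜ_ : (a b : Ty) → Dec (a ≡ b)
◇ ≟ₜ ◇ = yes refl
𝐁 ≟ₜ 𝐁 = yes refl
(a1 ⊸ a2) ≟ₜ (b1 ⊸ b2) with a1 ≟ₜ b1 | a2 ≟ₜ b2
... | yes refl | yes refl = yes refl
... | no p | _ = no λ { refl → p refl }
... | _ | no q = no λ { refl → q refl }
(a1 ⊗ a2) ≟ₜ (b1 ⊗ b2) with a1 ≟ₜ b1 | a2 ≟ₜ b2
... | yes refl | yes refl = yes refl
... | no p | _ = no λ { refl → p refl }
... | _ | no q = no λ { refl → q refl }
(a1 ×ₜ a2) ≟ₜ (b1 ×ₜ b2) with a1 ≟ₜ b1 | a2 ≟ₜ b2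
... | yes refl | yes refl = yes refl
... | no p | _ = no λ { refl → p refl }
... | _ | no q = no λ { refl → q refl }
(𝐋 a1) ≟ₜ (𝐋 b1) with a1 ≟ₜ b1
... | yes refl = yes refl
... | no p = no λ { refl → p refl }
◇ ≟ₜ 𝐁 = no (λ ())
◇ ≟ₜ (b1 ⊸ b2) = no (λ ())
◇ ≟ₜ (b1 ⊗ b2) = no (λ ())
◇ ≟ₜ (b1 ×ₜ b2) = no (λ ())
◇ ≟ₜ (𝐋 b1) = no (λ ())
𝐁 ≟ₜ ◇ = no (λ ())
𝐁 ≟ₜ (b1 ⊸ b2) = no (λ ())
𝐁 ≟ₜ (b1 ⊗ b2) = no (λ ())
𝐁 ≟ₜ (b1 ×ₜ b2) = no (λ ())
𝐁 ≟ₜ (𝐋 b1) = no (λ ())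
(a1 ⊸ a2) ≟ₜ ◇ = no (λ ())
(a1 ⊸ a2) ≟ₜ 𝐁 = no (λ ())
(a1 ⊸ a2) ≟ₜ (b1 ⊗ b2) = no (λ ())
(a1 ⊸ a2) ≟ₜ (b1 ×ₜ b2) = no (λ ())
(a1 ⊸ a2) ≟ₜ (𝐋 b1) = no (λ ())
(a1 ⊗ a2) ≟ₜ ◇ = no (λ ())
(a1 ⊗ a2) ≟ₜ 𝐁 = no (λ ())
(a1 ⊗ a2) ≟ₜ (b1 ⊸ b2) = no (λ ())
(a1 ⊗ a2) ≟ₜ (b1 ×ₜ b2) = no (λ ())
(a1 ⊗ a2) ≟ₜ (𝐋 b1) = no (λ ())
(a1 ×ₜ a2) ≟ₜ ◇ = no (λ ())
(a1 ×ₜ a2) ≟ₜ 𝐁 = no (λ ())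
(a1 ×ₜ a2) ≟ₜ (b1 ⊸ b2) = no (λ ())
(a1 ×ₜ a2) ≟ₜ (b1 ⊗ b2) = no (λ ())
(a1 ×ₜ a2) ≟ₜ (𝐋 b1) = no (λ ())
(𝐋 a1) ≟ₜ ◇ = no (λ ())
(𝐋 a1) ≟ₜ 𝐁 = no (λ ())
(𝐋 a1) ≟ₜ (b1 ⊸ b2) = no (λ ())
(𝐋 a1) ≟ₜ (b1 ⊗ b2) = no (λ ())
(𝐋 a1) ≟ₜ (b1 ×ₜ b2) = no (λ ())

Var : Set
Var = ℕ × Ty

vtype : Var → Ty
vtype (_ , τ) = τ

_≟ᵥ_ : (x y : Var) → Dec (x ≡ y)
_≟ᵥ_ = ≡-dec _≟_ _≟ₜ_

data Const : Set where
  tt ff : Const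
  nil   : Ty → Const
  cons  : Ty → Const
  tens  : Ty → Ty → Const

ctype : Const → Ty
ctype tt         = 𝐁
ctype ff         = 𝐁
ctype (nil τ)    = 𝐋 τ
ctype (cons τ)   = ◇ ⊸ τ ⊸ 𝐋 τ ⊸ 𝐋 τ
ctype (tens τ ρ) = τ ⊸ ρ ⊸ τ ⊗ ρ

-- Raw terms, in locally nameless representation (so that α-equivalent
-- terms are literally identical): free variables are named, bound
-- variables are de Bruijn indices.
--   fvar x      free variable x^τ
--   bvar i      bound variable (de Bruijn index)
--   con c       constant
--   lam τ t     λx^τ.t   (body t refers to x by bvar 0)
--   pair t s    ⟨t,s⟩
--   app t s     t s
--   brace t     {t}

data Term : Set where
  fvar  : Var → Term
  bvar  : ℕ → Term
  con   : Const → Term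
  lam   : Ty → Term → Term
  pair  : Term → Term → Term
  app   : Term → Term → Term
  brace : Term → Term

openAt : ℕ → Term → Term → Term
openAt k u (fvar x) = fvar x
openAt k u (bvar i) with k ≟ i
... | yes _ = u
... | no  _ = bvar i
openAt k u (con c)    = con c
openAt k u (lam τ t)  = lam τ (openAt (suc k) u t)
openAt k u (pair t s) = pair (openAt k u t) (openAt k u s)
openAt k u (app t s)  = app (openAt k u t) (openAt k u s)
openAt k u (brace t)  = brace (openAt k u t)

-- free variables (as a list, possibly with repetitions)
fvs : Term → List Var
fvs (fvar x)   = x ∷ []
fvs (bvar _)   = []
fvs (con _)    = []
fvs (lam _ t)  = fvs t
fvs (pair t s) = fvs t ++ fvs s
fvs (app t s)  = fvs t ++ fvs s
fvs (brace t)  = fvs t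

∣FV∣ : Term → ℕ
∣FV∣ t = length (deduplicate _≟ᵥ_ (fvs t))

-- Contexts: finite sets of variables, represented by lists read as sets.

Ctx : Set
Ctx = List Var

_≋_ : Ctx → Ctx → Set
Γ ≋ Δ = ∀ x → (x ∈ Γ → x ∈ Δ) × (x ∈ Δ → x ∈ Γ)

Disjoint : Ctx → Ctx → Set
Disjoint Γ Δ = ∀ x → x ∈ Γ → x ∉ Δ

-- Typing  Γ ⊢ t ∶ τ
-- Rules whose conclusion context is "Γ₁,Γ₂" take an arbitrary Γ having
-- the same elements as Γ₁ ++ Γ₂, with Γ₁, Γ₂ disjoint.

infix 3 _⊢_∶_

data _⊢_∶_ : Ctx → Term → Ty → Set where
  ⊢var   : ∀ {Γ x} → x ∈ Γ → Γ ⊢ fvar x ∶ vtype x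
  ⊢const : ∀ {Γ c} → Γ ⊢ con c ∶ ctype c
  ⊸⁺     : ∀ {Γ τ ρ t} (n : ℕ) → (n , τ) ∉ fvs t →
           ((n , τ) ∷ Γ) ⊢ openAt 0 (fvar (n , τ)) t ∶ ρ →
           Γ ⊢ lam τ t ∶ τ ⊸ ρ
  ⊸⁻     : ∀ {Γ Γ₁ Γ₂ t s τ ρ} → Disjoint Γ₁ Γ₂ → Γ ≋ (Γ₁ ++ Γ₂) →
           Γ₁ ⊢ t ∶ τ ⊸ ρ → Γ₂ ⊢ s ∶ τ → Γ ⊢ app t s ∶ ρ
  ×⁺     : ∀ {Γ t s τ ρ} → Γ ⊢ t ∶ τ → Γ ⊢ s ∶ ρ → Γ ⊢ pair t s ∶ τ ×ₜ ρ
  ×⁻₁    : ∀ {Γ t τ ρ} → Γ ⊢ t ∶ τ ×ₜ ρ → Γ ⊢ app t (con tt) ∶ τ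
  ×⁻₂    : ∀ {Γ t τ ρ} → Γ ⊢ t ∶ τ ×ₜ ρ → Γ ⊢ app t (con ff) ∶ ρ
  𝐁⁻     : ∀ {Γ Γ₁ Γ₂ t s r τ} → Disjoint Γ₁ Γ₂ → Γ ≋ (Γ₁ ++ Γ₂) →
           Γ₁ ⊢ t ∶ 𝐁 → Γ₂ ⊢ s ∶ τ → Γ₂ ⊢ r ∶ τ →
           Γ ⊢ app t (pair s r) ∶ τ
  -- premise context Γ₂,x^τ,y^ρ : x, y distinct and not in Γ₂;
  -- x, y fresh for the body; the body has x as bvar 1 and y as bvar 0
  ⊗⁻     : ∀ {Γ Γ₁ Γ₂ t s τ ρ σ} (n m : ℕ) →
           Disjoint Γ₁ Γ₂ → Γ ≋ (Γ₁ ++ Γ₂) →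
           (n , τ) ≢ (m , ρ) → (n , τ) ∉ Γ₂ → (m , ρ) ∉ Γ₂ →
           (n , τ) ∉ fvs s → (m , ρ) ∉ fvs s →
           Γ₁ ⊢ t ∶ τ ⊗ ρ →
           ((n , τ) ∷ (m , ρ) ∷ Γ₂) ⊢
               openAt 1 (fvar (n , τ)) (openAt 0 (fvar (m , ρ)) s) ∶ σ →
           Γ ⊢ app t (lam τ (lam ρ s)) ∶ σ
  𝐋⁻     : ∀ {Γ t s τ ρ} → Γ ⊢ t ∶ 𝐋 τ → [] ⊢ s ∶ ◇ ⊸ τ ⊸ ρ ⊸ ρ →
           Γ ⊢ app t (brace s) ∶ ρ ⊸ ρ

Typable : Term → Ty → Set
Typable t τ = ∃[ Γ ] (Γ ⊢ t ∶ τ)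

data IsListOf (τ : Ty) : ℕ → Term → Set where
  lnil  : IsListOf τ 0 (con (nil τ))
  lcons : ∀ {n d a ℓ} → Typable d ◇ → Typable a τ → IsListOf τ n ℓ →
          IsListOf τ (suc n) (app (app (app (con (cons τ)) d) a) ℓ)

IsList : ℕ → Term → Set
IsList n t = ∃[ τ ] IsListOf τ n t

infix 3 _↦_ _⟶_

data _↦_ : Term → Term → Set where
  β      : ∀ {τ t s} → app (lam τ t) s ↦ openAt 0 s t
  π₁     : ∀ {t s} → app (pair t s) (con tt) ↦ t
  π₂     : ∀ {t s} → app (pair t s) (con ff) ↦ s
  if-tt  : ∀ {t s} → app (con tt) (pair t s) ↦ t
  if-ff  : ∀ {t s} → app (con ff) (pair t s) ↦ s
  ⊗-conv : ∀ {τ ρ t s r} →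
           app (app (app (con (tens τ ρ)) t) s) (lam τ (lam ρ r))
             ↦ openAt 1 t (openAt 0 s r)
  nil-conv  : ∀ {τ t s} → app (app (con (nil τ)) (brace t)) s ↦ s
  cons-conv : ∀ {τ d a ℓ t s n} → IsList n ℓ →
           app (app (app (app (app (con (cons τ)) d) a) ℓ) (brace t)) s
             ↦ app (app (app t d) a) (app (app ℓ (brace t)) s)

data _⟶_ : Term → Term → Set where
  conv : ∀ {t t'} → t ↦ t' → t ⟶ t'
  appˡ : ∀ {t t' s} → t ⟶ t' → app t s ⟶ app t' s
  appʳ : ∀ {t s s'} → s ⟶ s' → app t s ⟶ app t s'

data Steps : ℕ → Term → Term → Set where
  done : ∀ {t} → Steps 0 t t
  step : ∀ {k t u v} → t ⟶ u → Steps k u v → Steps (suc k) t v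

size : Term → ℕ
size (fvar _)   = 1
size (bvar _)   = 1
size (con _)    = 1
size (lam _ t)  = suc (size t)
size (pair t s) = suc (size t ⊔ size s)
size (app t s)  = size t + size s
size (brace _)  = 0

-- The polynomial bound π(t) ∈ ℕ^poly, as a (classically total and
-- functional) relation  Πb t f  ("π(t) = f"), since the side condition
-- "t is a list" involves typability.  X_n(N) = n ⊓ N.

data Πb : Term → (ℕ → ℕ) → Set where
  πvar   : ∀ {x} → Πb (fvar x) (λ _ → 0)
  πbvar  : ∀ {i} → Πb (bvar i) (λ _ → 0)
  πconst : ∀ {c} → Πb (con c) (λ _ → 0)
  πlam   : ∀ {τ t f} (n : ℕ) → (n , τ) ∉ fvs t →
           Πb (openAt 0 (fvar (n , τ)) t) f → Πb (lam τ t) f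
  πpair  : ∀ {t s f g} → Πb t f → Πb s g → Πb (pair t s) (λ N → f N ⊔ g N)
  πbrace : ∀ {h g} → Πb h g → Πb (brace h) (λ N → N * g N + N * size h)
  πappL  : ∀ {t h n f g} → IsList n t → Πb t f → Πb h g →
           Πb (app t (brace h))
              (λ N → f N + (n ⊓ N) * g N + (n ⊓ N) * size h)
  πapp   : ∀ {t s f g} → ¬ (∃[ n ] ∃[ h ] (IsList n t × s ≡ brace h)) →
           Πb t f → Πb s g → Πb (app t s) (λ N → f N + g N)

{-# OPTIONS --safe #-}

-- For β and ⊗ the contractum is a
-- substitution instance of the body, and linearity gives π(r[s/x]) ≤ π(r) + π(s) and
-- |r[s/x]| ≤ |r| + |s|, while the redex loses at least one node. The list unfolding
-- cons d a ℓ {h} s ↦ h d a (ℓ {h} s) duplicates h, but the weight X·(π(h) + |h|) of h is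
-- charged with the factor X_{n+1}(N) in the redex and X_n(N) in the contractum, and these
-- differ by one as long as n + 1 ≤ N. That holds because every entry of a list has type ◇,
-- which is empty in the set-theoretic model, so each entry has a free variable, and by
-- linearity these are distinct: a list has at most |FV| entries. Reduction creates no free
-- variables, so N ≥ |FV| persists along a reduction sequence, which bounds its length.

module Submission where

open import Defs
open import Data.Nat using (ℕ; suc; _+_; _*_; _⊔_; _⊓_; _≤_; _<_; z≤n; s≤s; _≟_)
open import Data.Nat.Properties
open import Data.Nat.Tactic.RingSolver using (solve-∀)
open import Algebra.Properties.CommutativeSemigroup +-commutativeSemigroup using (interchange; xy∙z≈xz∙y)
open import Data.Product using (∃; ∃₂; ∃-syntax; _×_; _,_; proj₁; proj₂)
open import Data.Sum using (inj₁; inj₂; [_,_])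
open import Data.List using (List; []; _∷_; _++_; length; map; filter; deduplicate)
open import Data.List.Membership.Propositional using (_∈_; _∉_)
open import Data.List.Membership.Propositional.Properties
open import Data.List.Membership.DecPropositional _≟ᵥ_ using (_∈?_; _∉?_)
open import Data.List.Relation.Binary.Subset.Propositional using (_⊆_)
import Data.List.Relation.Binary.Subset.Propositional.Properties as ⊆
open import Data.List.Relation.Unary.Any as Any using (Any; here; there)
import Data.List.Relation.Unary.All as All
open import Data.List.Relation.Unary.All.Properties using (¬Any⇒All¬)
open import Data.List.Relation.Unary.Unique.Propositional using (Unique; []; _∷_)
open import Data.List.Relation.Unary.Unique.DecPropositional.Properties _≟ᵥ_ using (deduplicate-!)
open import Data.List.Properties using (filter-notAll; map-++)
open import Data.Empty using (⊥; ⊥-elim)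
open import Data.Bool using (Bool; true; false; if_then_else_)
open import Data.Unit using (⊤) renaming (tt to unit)
open import Function using (_∘_; id)
open import Relation.Nullary using (¬_; Dec; yes; no; ¬?)
open import Relation.Binary.Definitions using (DecidableEquality)
open import Relation.Binary.PropositionalEquality
  using (_≡_; _≢_; refl; sym; trans; cong; cong₂; subst; subst₂; module ≡-Reasoning)

fresh : List Var → ℕ
fresh []            = 0
fresh ((n , _) ∷ L) = suc n ⊔ fresh L

fresh-> : ∀ {n τ} L → (n , τ) ∈ L → n < fresh L
fresh-> ((n , _) ∷ L) (here refl) = m≤m⊔n (suc n) (fresh L)
fresh-> ((n , _) ∷ L) (there p)   = ≤-trans (fresh-> L p) (m≤n⊔m (suc n) (fresh L))

fresh-∉ : ∀ L τ → (fresh L , τ) ∉ L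
fresh-∉ L τ p = <-irrefl refl (fresh-> L p)

record Fresh₂ (L : List Var) (τ ρ : Ty) : Set where
  field
    n m : ℕ
    n∉  : (n , τ) ∉ L
    m∉  : (m , ρ) ∉ L
    n≢m : (n , τ) ≢ (m , ρ)

fresh₂ : ∀ L τ ρ → Fresh₂ L τ ρ
fresh₂ L τ ρ = record
  { n = fresh L ; m = fresh ((fresh L , τ) ∷ L)
  ; n∉ = fresh-∉ L τ
  ; m∉ = fresh-∉ ((fresh L , τ) ∷ L) ρ ∘ there
  ; n≢m = λ e → fresh-∉ ((fresh L , τ) ∷ L) ρ (here (sym e)) }

∉-≡[] : ∀ {y : Var} {A} → A ≡ [] → y ∉ A
∉-≡[] refl ()

++-⊆ : ∀ {A B C : List Var} → A ⊆ C → B ⊆ C → A ++ B ⊆ C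
++-⊆ {A} A⊆C B⊆C p with ∈-++⁻ A p
... | inj₁ q = A⊆C q
... | inj₂ q = B⊆C q

⊆-++-common : ∀ {A B T S : List Var} U → A ⊆ U ++ T → B ⊆ U ++ S → A ++ B ⊆ U ++ T ++ S
⊆-++-common {A} {T = T} U A⊆ B⊆ p with ∈-++⁻ A p
... | inj₁ q = ⊆.++⁺ʳ U (⊆.xs⊆xs++ys _ _) (A⊆ q)
... | inj₂ q = ⊆.++⁺ʳ U (⊆.xs⊆ys++xs _ T) (B⊆ q)

Disjoint-∷ : ∀ {x : Var} {A B} → x ∉ B → Disjoint A B → Disjoint (x ∷ A) B
Disjoint-∷ x∉ d y (here refl) = x∉
Disjoint-∷ x∉ d y (there p)   = d y p

Disjoint-mono : ∀ {A A' B B'} → A' ⊆ A → B' ⊆ B → Disjoint A B → Disjoint A' B'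
Disjoint-mono A'⊆A B'⊆B d y p q = d y (A'⊆A p) (B'⊆B q)

Disjoint-sym : ∀ {A B} → Disjoint A B → Disjoint B A
Disjoint-sym d y p q = d y q p

Disjoint-++ : ∀ {A B C} → Disjoint A C → Disjoint B C → Disjoint (A ++ B) C
Disjoint-++ {A} dA dB y p with ∈-++⁻ A p
... | inj₁ q = dA y q
... | inj₂ q = dB y q

Disjoint-++ʳ : ∀ {A B C} → Disjoint A B → Disjoint A C → Disjoint A (B ++ C)
Disjoint-++ʳ dB dC = Disjoint-sym (Disjoint-++ (Disjoint-sym dB) (Disjoint-sym dC))

Disjoint-≡[]ˡ : ∀ {A B : List Var} → A ≡ [] → Disjoint A B
Disjoint-≡[]ˡ e y p = ⊥-elim (∉-≡[] e p)

≡[]⇒⊆ : ∀ {A B : List Var} → A ≡ [] → A ⊆ B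
≡[]⇒⊆ e p = ⊥-elim (∉-≡[] e p)

Unique-⊆⇒length≤ : ∀ {A : Set} (_≟_ : DecidableEquality A) {xs ys : List A} →
  Unique xs → xs ⊆ ys → length xs ≤ length ys
Unique-⊆⇒length≤ _≟_ [] _ = z≤n
Unique-⊆⇒length≤ _≟_ {x ∷ xs} {ys} (x∉xs ∷ u) sub = begin-strict
  length xs                         ≤⟨ Unique-⊆⇒length≤ _≟_ u xs⊆ys-x ⟩
  length (filter (¬? ∘ (x ≟_)) ys)  <⟨ filter-notAll (¬? ∘ (x ≟_)) ys x∈ys ⟩
  length ys                         ∎
  where
    open ≤-Reasoning
    xs⊆ys-x : xs ⊆ filter (¬? ∘ (x ≟_)) ys
    xs⊆ys-x p = ∈-filter⁺ (¬? ∘ (x ≟_)) (sub (there p)) (All.lookup x∉xs p)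
    x∈ys : Any (λ z → ¬ ¬ (x ≡ z)) ys
    x∈ys = Any.map (λ x≡z x≢z → x≢z x≡z) (sub (here refl))

Unique⊆fvs⇒≤∣FV∣ : ∀ {xs} t → Unique xs → xs ⊆ fvs t → length xs ≤ ∣FV∣ t
Unique⊆fvs⇒≤∣FV∣ t u sub = Unique-⊆⇒length≤ _≟ᵥ_ u (∈-deduplicate⁺ _≟ᵥ_ ∘ sub)

∣FV∣-mono : ∀ u t → fvs u ⊆ fvs t → ∣FV∣ u ≤ ∣FV∣ t
∣FV∣-mono u t sub =
  Unique⊆fvs⇒≤∣FV∣ t (deduplicate-! (fvs u)) (sub ∘ ∈-deduplicate⁻ _≟ᵥ_ (fvs u))

open₂ : Var → Var → Term → Term
open₂ x y r = openAt 1 (fvar x) (openAt 0 (fvar y) r)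

fvs-openAt⁺ : ∀ k u t → fvs t ⊆ fvs (openAt k u t)
fvs-openAt⁺ k u (fvar x)   p = p
fvs-openAt⁺ k u (lam τ t)  p = fvs-openAt⁺ (suc k) u t p
fvs-openAt⁺ k u (pair t s) p = ⊆.++⁺ (fvs-openAt⁺ k u t) (fvs-openAt⁺ k u s) p
fvs-openAt⁺ k u (app t s)  p = ⊆.++⁺ (fvs-openAt⁺ k u t) (fvs-openAt⁺ k u s) p
fvs-openAt⁺ k u (brace t)  p = fvs-openAt⁺ k u t p

fvs-openAt⁻ : ∀ k u t → fvs (openAt k u t) ⊆ fvs u ++ fvs t
fvs-openAt⁻ k u (fvar x) p = ∈-++⁺ʳ (fvs u) p
fvs-openAt⁻ k u (bvar i) p with k ≟ i
... | yes _ = ∈-++⁺ˡ p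
fvs-openAt⁻ k u (lam τ t)  p = fvs-openAt⁻ (suc k) u t p
fvs-openAt⁻ k u (pair t s) p = ⊆-++-common (fvs u) (fvs-openAt⁻ k u t) (fvs-openAt⁻ k u s) p
fvs-openAt⁻ k u (app t s)  p = ⊆-++-common (fvs u) (fvs-openAt⁻ k u t) (fvs-openAt⁻ k u s) p
fvs-openAt⁻ k u (brace t)  p = fvs-openAt⁻ k u t p

fvs-open₂⁻ : ∀ x y r → fvs (open₂ x y r) ⊆ x ∷ y ∷ fvs r
fvs-open₂⁻ x y r p with fvs-openAt⁻ 1 (fvar x) (openAt 0 (fvar y) r) p
... | here e  = here e
... | there q = there (fvs-openAt⁻ 0 (fvar y) r q)

open₂-cong : ∀ {x x' y y' r r'} → x ≡ x' → y ≡ y' → r ≡ r' → open₂ x y r ≡ open₂ x' y' r'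
open₂-cong refl refl refl = refl

fvs-open₂⁺ : ∀ x y r → fvs r ⊆ fvs (open₂ x y r)
fvs-open₂⁺ x y r = fvs-openAt⁺ 1 (fvar x) (openAt 0 (fvar y) r) ∘ fvs-openAt⁺ 0 (fvar y) r

size-openAt-var : ∀ k x t → size (openAt k (fvar x) t) ≡ size t
size-openAt-var k x (fvar y) = refl
size-openAt-var k x (bvar i) with k ≟ i
... | yes _ = refl
... | no _  = refl
size-openAt-var k x (con c)    = refl
size-openAt-var k x (lam τ t)  = cong suc (size-openAt-var (suc k) x t)
size-openAt-var k x (pair t s) = cong₂ (λ a b → suc (a ⊔ b)) (size-openAt-var k x t) (size-openAt-var k x s)
size-openAt-var k x (app t s)  = cong₂ _+_ (size-openAt-var k x t) (size-openAt-var k x s)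
size-openAt-var k x (brace t)  = refl

size-open₂ : ∀ x y r → size (open₂ x y r) ≡ size r
size-open₂ x y r = trans (size-openAt-var 1 x (openAt 0 (fvar y) r)) (size-openAt-var 0 y r)

openAt-bvar-self : ∀ k u → openAt k u (bvar k) ≡ u
openAt-bvar-self k u with k ≟ k
... | yes _   = refl
... | no k≢k = ⊥-elim (k≢k refl)

openAt-bvar-other : ∀ {k i u} → k ≢ i → openAt k u (bvar i) ≡ bvar i
openAt-bvar-other {k} {i} k≢i with k ≟ i
... | yes k≡i = ⊥-elim (k≢i k≡i)
... | no _    = refl

LocallyClosed : Term → Set
LocallyClosed t = ∀ k u → openAt k u t ≡ t

openAt-comm : ∀ i j x y t → i ≢ j →
  openAt i (fvar x) (openAt j (fvar y) t) ≡ openAt j (fvar y) (openAt i (fvar x) t)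
openAt-comm i j x y (fvar z) i≢j = refl
openAt-comm i j x y (bvar l) i≢j with j ≟ l | i ≟ l
... | yes refl | yes refl = ⊥-elim (i≢j refl)
... | yes refl | no _     = sym (openAt-bvar-self j (fvar y))
... | no _     | yes refl = openAt-bvar-self i (fvar x)
... | no j≢l   | no i≢l   = trans (openAt-bvar-other i≢l) (sym (openAt-bvar-other j≢l))
openAt-comm i j x y (con c)    i≢j = refl
openAt-comm i j x y (lam τ t)  i≢j = cong (lam τ) (openAt-comm (suc i) (suc j) x y t (i≢j ∘ suc-injective))
openAt-comm i j x y (pair t s) i≢j = cong₂ pair (openAt-comm i j x y t i≢j) (openAt-comm i j x y s i≢j)
openAt-comm i j x y (app t s)  i≢j = cong₂ app (openAt-comm i j x y t i≢j) (openAt-comm i j x y s i≢j)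
openAt-comm i j x y (brace t)  i≢j = cong brace (openAt-comm i j x y t i≢j)

lam-injective : ∀ {τ a b} → lam τ a ≡ lam τ b → a ≡ b
lam-injective refl = refl

pair-injective : ∀ {a b c d} → pair a b ≡ pair c d → a ≡ c × b ≡ d
pair-injective refl = refl , refl

app-injective : ∀ {a b c d} → app a b ≡ app c d → a ≡ c × b ≡ d
app-injective refl = refl , refl

brace-injective : ∀ {a b} → brace a ≡ brace b → a ≡ b
brace-injective refl = refl

openAt-fixed-before-openAt : ∀ i j v x t → i ≢ j →
  openAt i v (openAt j (fvar x) t) ≡ openAt j (fvar x) t → openAt i v t ≡ t
openAt-fixed-before-openAt i j v x (fvar y) i≢j e = refl
openAt-fixed-before-openAt i j v x (bvar l) i≢j e with j ≟ l
... | yes refl = openAt-bvar-other i≢j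
... | no _     = e
openAt-fixed-before-openAt i j v x (con c) i≢j e = refl
openAt-fixed-before-openAt i j v x (lam τ t) i≢j e =
  cong (lam τ) (openAt-fixed-before-openAt (suc i) (suc j) v x t (i≢j ∘ suc-injective) (lam-injective e))
openAt-fixed-before-openAt i j v x (pair t s) i≢j e =
  cong₂ pair (openAt-fixed-before-openAt i j v x t i≢j (proj₁ (pair-injective e)))
             (openAt-fixed-before-openAt i j v x s i≢j (proj₂ (pair-injective e)))
openAt-fixed-before-openAt i j v x (app t s) i≢j e =
  cong₂ app (openAt-fixed-before-openAt i j v x t i≢j (proj₁ (app-injective e)))
            (openAt-fixed-before-openAt i j v x s i≢j (proj₂ (app-injective e)))
openAt-fixed-before-openAt i j v x (brace t) i≢j e =
  cong brace (openAt-fixed-before-openAt i j v x t i≢j (brace-injective e))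

infix 8 _[_≔_]

_[_≔_] : Term → Var → Term → Term
fvar y     [ x ≔ s ] with y ≟ᵥ x
... | yes _ = s
... | no _  = fvar y
bvar i     [ x ≔ s ] = bvar i
con c      [ x ≔ s ] = con c
lam τ t    [ x ≔ s ] = lam τ (t [ x ≔ s ])
pair t u   [ x ≔ s ] = pair (t [ x ≔ s ]) (u [ x ≔ s ])
app t u    [ x ≔ s ] = app (t [ x ≔ s ]) (u [ x ≔ s ])
brace t    [ x ≔ s ] = brace (t [ x ≔ s ])

var-[≔]-self : ∀ x s → fvar x [ x ≔ s ] ≡ s
var-[≔]-self x s with x ≟ᵥ x
... | yes _   = refl
... | no x≢x = ⊥-elim (x≢x refl)

var-[≔]-other : ∀ {x y} s → y ≢ x → fvar y [ x ≔ s ] ≡ fvar y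
var-[≔]-other {x} {y} s y≢x with y ≟ᵥ x
... | yes y≡x = ⊥-elim (y≢x y≡x)
... | no _    = refl

[≔]-fresh : ∀ x s t → x ∉ fvs t → t [ x ≔ s ] ≡ t
[≔]-fresh x s (fvar y)   x∉ = var-[≔]-other s (x∉ ∘ here ∘ sym)
[≔]-fresh x s (bvar i)   x∉ = refl
[≔]-fresh x s (con c)    x∉ = refl
[≔]-fresh x s (lam τ t)  x∉ = cong (lam τ) ([≔]-fresh x s t x∉)
[≔]-fresh x s (pair t u) x∉ =
  cong₂ pair ([≔]-fresh x s t (x∉ ∘ ∈-++⁺ˡ)) ([≔]-fresh x s u (x∉ ∘ ∈-++⁺ʳ (fvs t)))
[≔]-fresh x s (app t u)  x∉ =
  cong₂ app ([≔]-fresh x s t (x∉ ∘ ∈-++⁺ˡ)) ([≔]-fresh x s u (x∉ ∘ ∈-++⁺ʳ (fvs t)))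
[≔]-fresh x s (brace t)  x∉ = cong brace ([≔]-fresh x s t x∉)

[≔]-openAt : ∀ x s k u t → LocallyClosed s →
  openAt k u t [ x ≔ s ] ≡ openAt k (u [ x ≔ s ]) (t [ x ≔ s ])
[≔]-openAt x s k u (fvar y) lc with y ≟ᵥ x
... | yes _ = sym (lc k _)
... | no _  = refl
[≔]-openAt x s k u (bvar i) lc with k ≟ i
... | yes _ = refl
... | no _  = refl
[≔]-openAt x s k u (con c)    lc = refl
[≔]-openAt x s k u (lam τ t)  lc = cong (lam τ) ([≔]-openAt x s (suc k) u t lc)
[≔]-openAt x s k u (pair t v) lc = cong₂ pair ([≔]-openAt x s k u t lc) ([≔]-openAt x s k u v lc)
[≔]-openAt x s k u (app t v)  lc = cong₂ app ([≔]-openAt x s k u t lc) ([≔]-openAt x s k u v lc)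
[≔]-openAt x s k u (brace t)  lc = cong brace ([≔]-openAt x s k u t lc)

[≔]-openAt-var : ∀ x s k y t → LocallyClosed s → y ≢ x →
  openAt k (fvar y) t [ x ≔ s ] ≡ openAt k (fvar y) (t [ x ≔ s ])
[≔]-openAt-var x s k y t lc y≢x =
  trans ([≔]-openAt x s k (fvar y) t lc) (cong (λ v → openAt k v (t [ x ≔ s ])) (var-[≔]-other s y≢x))

[≔]-open₂ : ∀ x s y z r → LocallyClosed s → y ≢ x → z ≢ x →
  open₂ y z r [ x ≔ s ] ≡ open₂ y z (r [ x ≔ s ])
[≔]-open₂ x s y z r lc y≢x z≢x =
  trans ([≔]-openAt-var x s 1 y (openAt 0 (fvar z) r) lc y≢x)
        (cong (openAt 1 (fvar y)) ([≔]-openAt-var x s 0 z r lc z≢x))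

[≔]-openAt-self : ∀ x s k t → LocallyClosed s → x ∉ fvs t →
  openAt k (fvar x) t [ x ≔ s ] ≡ openAt k s t
[≔]-openAt-self x s k t lc x∉ =
  trans ([≔]-openAt x s k (fvar x) t lc) (cong₂ (openAt k) (var-[≔]-self x s) ([≔]-fresh x s t x∉))

fvs-[≔] : ∀ x s t → fvs (t [ x ≔ s ]) ⊆ fvs s ++ fvs t
fvs-[≔] x s (fvar y) p with y ≟ᵥ x
... | yes _ = ∈-++⁺ˡ p
... | no _  = ∈-++⁺ʳ (fvs s) p
fvs-[≔] x s (lam τ t)  p = fvs-[≔] x s t p
fvs-[≔] x s (pair t u) p = ⊆-++-common (fvs s) (fvs-[≔] x s t) (fvs-[≔] x s u) p
fvs-[≔] x s (app t u)  p = ⊆-++-common (fvs s) (fvs-[≔] x s t) (fvs-[≔] x s u) p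
fvs-[≔] x s (brace t)  p = fvs-[≔] x s t p

-- Linear typing without contexts: linearity becomes disjointness of the free variables
-- of the two sides of an elimination, and binders are quantified cofinitely.

infix 3 _⦂_

data _⦂_ : Term → Ty → Set where
  ⦂var  : ∀ {x} → fvar x ⦂ vtype x
  ⦂con  : ∀ {c} → con c ⦂ ctype c
  ⦂lam  : ∀ {τ ρ b} (L : List Var) →
          (∀ n → (n , τ) ∉ L → openAt 0 (fvar (n , τ)) b ⦂ ρ) → lam τ b ⦂ τ ⊸ ρ
  ⦂app  : ∀ {t s τ ρ} → t ⦂ τ ⊸ ρ → s ⦂ τ → Disjoint (fvs t) (fvs s) → app t s ⦂ ρ
  ⦂pair : ∀ {t s τ ρ} → t ⦂ τ → s ⦂ ρ → pair t s ⦂ τ ×ₜ ρ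
  ⦂fst  : ∀ {t τ ρ} → t ⦂ τ ×ₜ ρ → app t (con tt) ⦂ τ
  ⦂snd  : ∀ {t τ ρ} → t ⦂ τ ×ₜ ρ → app t (con ff) ⦂ ρ
  ⦂if   : ∀ {t s r τ} → t ⦂ 𝐁 → s ⦂ τ → r ⦂ τ → Disjoint (fvs t) (fvs s ++ fvs r) →
          app t (pair s r) ⦂ τ
  ⦂let⊗ : ∀ {t r τ ρ σ} → t ⦂ τ ⊗ ρ → (L : List Var) →
          (∀ n m → (n , τ) ∉ L → (m , ρ) ∉ L → (n , τ) ≢ (m , ρ) →
            open₂ (n , τ) (m , ρ) r ⦂ σ) →
          Disjoint (fvs t) (fvs r) → app t (lam τ (lam ρ r)) ⦂ σ
  ⦂fold : ∀ {t s τ ρ} → t ⦂ 𝐋 τ → s ⦂ ◇ ⊸ τ ⊸ ρ ⊸ ρ → fvs s ≡ [] →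
          app t (brace s) ⦂ ρ ⊸ ρ

-- Bound names are renamed by swapping, an involution, so no freshness conditions arise.

module Swap (τ : Ty) (a b : ℕ) where

  swapName : Var → ℕ
  swapName x with x ≟ᵥ (a , τ)
  ... | yes _ = b
  ... | no _ with x ≟ᵥ (b , τ)
  ...   | yes _ = a
  ...   | no _  = proj₁ x

  swapV : Var → Var
  swapV x = swapName x , vtype x

  swapV-a : swapV (a , τ) ≡ (b , τ)
  swapV-a with (a , τ) ≟ᵥ (a , τ)
  ... | yes _   = refl
  ... | no a≢a = ⊥-elim (a≢a refl)

  swapV-b : swapV (b , τ) ≡ (a , τ)
  swapV-b with (b , τ) ≟ᵥ (a , τ)
  ... | yes b≡a = b≡a
  ... | no _ with (b , τ) ≟ᵥ (b , τ)
  ...   | yes _   = refl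
  ...   | no b≢b = ⊥-elim (b≢b refl)

  swapV-other : ∀ x → x ≢ (a , τ) → x ≢ (b , τ) → swapV x ≡ x
  swapV-other x x≢a x≢b with x ≟ᵥ (a , τ)
  ... | yes x≡a = ⊥-elim (x≢a x≡a)
  ... | no _ with x ≟ᵥ (b , τ)
  ...   | yes x≡b = ⊥-elim (x≢b x≡b)
  ...   | no _    = refl

  swapV-involutive : ∀ x → swapV (swapV x) ≡ x
  swapV-involutive x with x ≟ᵥ (a , τ)
  ... | yes refl = swapV-b
  ... | no x≢a with x ≟ᵥ (b , τ)
  ...   | yes refl = swapV-a
  ...   | no x≢b   = swapV-other x x≢a x≢b

  swapV-injective : ∀ {x y} → swapV x ≡ swapV y → x ≡ y
  swapV-injective {x} {y} e = trans (sym (swapV-involutive x)) (trans (cong swapV e) (swapV-involutive y))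

  swapT : Term → Term
  swapT (fvar x)   = fvar (swapV x)
  swapT (bvar i)   = bvar i
  swapT (con c)    = con c
  swapT (lam σ t)  = lam σ (swapT t)
  swapT (pair t s) = pair (swapT t) (swapT s)
  swapT (app t s)  = app (swapT t) (swapT s)
  swapT (brace t)  = brace (swapT t)

  swapT-openAt : ∀ k u t → swapT (openAt k u t) ≡ openAt k (swapT u) (swapT t)
  swapT-openAt k u (fvar x) = refl
  swapT-openAt k u (bvar i) with k ≟ i
  ... | yes _ = refl
  ... | no _  = refl
  swapT-openAt k u (con c)    = refl
  swapT-openAt k u (lam σ t)  = cong (lam σ) (swapT-openAt (suc k) u t)
  swapT-openAt k u (pair t s) = cong₂ pair (swapT-openAt k u t) (swapT-openAt k u s)
  swapT-openAt k u (app t s)  = cong₂ app (swapT-openAt k u t) (swapT-openAt k u s)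
  swapT-openAt k u (brace t)  = cong brace (swapT-openAt k u t)

  swapT-involutive : ∀ t → swapT (swapT t) ≡ t
  swapT-involutive (fvar x)   = cong fvar (swapV-involutive x)
  swapT-involutive (bvar i)   = refl
  swapT-involutive (con c)    = refl
  swapT-involutive (lam σ t)  = cong (lam σ) (swapT-involutive t)
  swapT-involutive (pair t s) = cong₂ pair (swapT-involutive t) (swapT-involutive s)
  swapT-involutive (app t s)  = cong₂ app (swapT-involutive t) (swapT-involutive s)
  swapT-involutive (brace t)  = cong brace (swapT-involutive t)

  swapT-fresh : ∀ t → (a , τ) ∉ fvs t → (b , τ) ∉ fvs t → swapT t ≡ t
  swapT-fresh (fvar x) a∉ b∉ = cong fvar (swapV-other x (a∉ ∘ here ∘ sym) (b∉ ∘ here ∘ sym))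
  swapT-fresh (bvar i) a∉ b∉ = refl
  swapT-fresh (con c)  a∉ b∉ = refl
  swapT-fresh (lam σ t) a∉ b∉ = cong (lam σ) (swapT-fresh t a∉ b∉)
  swapT-fresh (pair t s) a∉ b∉ =
    cong₂ pair (swapT-fresh t (a∉ ∘ ∈-++⁺ˡ) (b∉ ∘ ∈-++⁺ˡ))
               (swapT-fresh s (a∉ ∘ ∈-++⁺ʳ (fvs t)) (b∉ ∘ ∈-++⁺ʳ (fvs t)))
  swapT-fresh (app t s) a∉ b∉ =
    cong₂ app (swapT-fresh t (a∉ ∘ ∈-++⁺ˡ) (b∉ ∘ ∈-++⁺ˡ))
              (swapT-fresh s (a∉ ∘ ∈-++⁺ʳ (fvs t)) (b∉ ∘ ∈-++⁺ʳ (fvs t)))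
  swapT-fresh (brace t) a∉ b∉ = cong brace (swapT-fresh t a∉ b∉)

  fvs-swapT : ∀ t → fvs (swapT t) ≡ map swapV (fvs t)
  fvs-swapT (fvar x)   = refl
  fvs-swapT (bvar i)   = refl
  fvs-swapT (con c)    = refl
  fvs-swapT (lam σ t)  = fvs-swapT t
  fvs-swapT (pair t s) = trans (cong₂ _++_ (fvs-swapT t) (fvs-swapT s)) (sym (map-++ swapV (fvs t) (fvs s)))
  fvs-swapT (app t s)  = trans (cong₂ _++_ (fvs-swapT t) (fvs-swapT s)) (sym (map-++ swapV (fvs t) (fvs s)))
  fvs-swapT (brace t)  = fvs-swapT t

  size-swapT : ∀ t → size (swapT t) ≡ size t
  size-swapT (fvar x)   = refl
  size-swapT (bvar i)   = refl
  size-swapT (con c)    = refl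
  size-swapT (lam σ t)  = cong suc (size-swapT t)
  size-swapT (pair t s) = cong₂ (λ m n → suc (m ⊔ n)) (size-swapT t) (size-swapT s)
  size-swapT (app t s)  = cong₂ _+_ (size-swapT t) (size-swapT s)
  size-swapT (brace t)  = refl

  ∈-map-swapV⁻ : ∀ {y L} → swapV y ∈ map swapV L → y ∈ L
  ∈-map-swapV⁻ p with ∈-map⁻ swapV p
  ... | z , z∈L , e = subst (_∈ _) (sym (swapV-injective e)) z∈L

  ∈-map-swapV⁺ : ∀ {y L} → y ∈ L → swapV y ∈ map swapV L
  ∈-map-swapV⁺ = ∈-map⁺ swapV

  ∉-map-swapV : ∀ {y L} → y ∉ map swapV L → swapV y ∉ L
  ∉-map-swapV {y} y∉ p = y∉ (subst (_∈ _) (swapV-involutive y) (∈-map-swapV⁺ p))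

  ∉-fvs-swapT : ∀ {y} t → y ∉ fvs t → swapV y ∉ fvs (swapT t)
  ∉-fvs-swapT t y∉ p = y∉ (∈-map-swapV⁻ (subst (_ ∈_) (fvs-swapT t) p))

  Disjoint-swapT : ∀ t s → Disjoint (fvs t) (fvs s) → Disjoint (fvs (swapT t)) (fvs (swapT s))
  Disjoint-swapT t s d y p q = d (swapV y) (from t p) (from s q)
    where
      from : ∀ u → y ∈ fvs (swapT u) → swapV y ∈ fvs u
      from u p = ∈-map-swapV⁻ (subst (_∈ _) (sym (swapV-involutive y)) (subst (_ ∈_) (fvs-swapT u) p))

  swapT-rename : ∀ k t → (a , τ) ∉ fvs t → (b , τ) ∉ fvs t →
    swapT (openAt k (fvar (a , τ)) t) ≡ openAt k (fvar (b , τ)) t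
  swapT-rename k t a∉ b∉ =
    trans (swapT-openAt k (fvar (a , τ)) t) (cong₂ (λ x → openAt k (fvar x)) swapV-a (swapT-fresh t a∉ b∉))

  swapT-open₂ : ∀ x y r → swapT (open₂ x y r) ≡ open₂ (swapV x) (swapV y) (swapT r)
  swapT-open₂ x y r =
    trans (swapT-openAt 1 (fvar x) (openAt 0 (fvar y) r))
          (cong (openAt 1 (fvar (swapV x))) (swapT-openAt 0 (fvar y) r))

  swapT-open₂-renameˡ : ∀ y r → (a , τ) ∉ fvs r → (b , τ) ∉ fvs r →
    y ≢ (a , τ) → y ≢ (b , τ) →
    swapT (open₂ (a , τ) y r) ≡ open₂ (b , τ) y r
  swapT-open₂-renameˡ y r a∉ b∉ y≢a y≢b =
    trans (swapT-open₂ (a , τ) y r) (open₂-cong swapV-a (swapV-other y y≢a y≢b) (swapT-fresh r a∉ b∉))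

  swapT-open₂-renameʳ : ∀ x r → (a , τ) ∉ fvs r → (b , τ) ∉ fvs r →
    x ≢ (a , τ) → x ≢ (b , τ) →
    swapT (open₂ x (a , τ) r) ≡ open₂ x (b , τ) r
  swapT-open₂-renameʳ x r a∉ b∉ x≢a x≢b =
    trans (swapT-open₂ x (a , τ) r) (open₂-cong (swapV-other x x≢a x≢b) swapV-a (swapT-fresh r a∉ b∉))

  swapT-openAt-swapped : ∀ k x t → swapT (openAt k (fvar (swapV x)) t) ≡ openAt k (fvar x) (swapT t)
  swapT-openAt-swapped k x t =
    trans (swapT-openAt k (fvar (swapV x)) t) (cong (λ v → openAt k (fvar v) (swapT t)) (swapV-involutive x))

  swapT-open₂-swapped : ∀ x y r → swapT (open₂ (swapV x) (swapV y) r) ≡ open₂ x y (swapT r)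
  swapT-open₂-swapped x y r =
    trans (swapT-openAt-swapped 1 x (openAt 0 (fvar (swapV y)) r))
          (cong (openAt 1 (fvar x)) (swapT-openAt-swapped 0 y r))

  ⦂-swapT : ∀ {t σ} → t ⦂ σ → swapT t ⦂ σ
  ⦂-swapT ⦂var = ⦂var
  ⦂-swapT ⦂con = ⦂con
  ⦂-swapT (⦂lam {σ} {ρ} {b} L f) = ⦂lam (map swapV L) λ n n∉ →
    subst (_⦂ ρ) (swapT-openAt-swapped 0 (n , σ) b) (⦂-swapT (f _ (∉-map-swapV n∉)))
  ⦂-swapT (⦂app {t} {s} D E d) = ⦂app (⦂-swapT D) (⦂-swapT E) (Disjoint-swapT t s d)
  ⦂-swapT (⦂pair D E) = ⦂pair (⦂-swapT D) (⦂-swapT E)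
  ⦂-swapT (⦂fst D) = ⦂fst (⦂-swapT D)
  ⦂-swapT (⦂snd D) = ⦂snd (⦂-swapT D)
  ⦂-swapT (⦂if {t} {s} {r} D E F d) =
    ⦂if (⦂-swapT D) (⦂-swapT E) (⦂-swapT F) (Disjoint-swapT t (pair s r) d)
  ⦂-swapT (⦂let⊗ {t} {r} {σ} {ρ} D L f d) = ⦂let⊗ (⦂-swapT D) (map swapV L)
    (λ n m n∉ m∉ n≢m → subst (_⦂ _) (swapT-open₂-swapped (n , σ) (m , ρ) r)
       (⦂-swapT (f _ _ (∉-map-swapV n∉) (∉-map-swapV m∉) (n≢m ∘ swapV-injective))))
    (Disjoint-swapT t r d)
  ⦂-swapT (⦂fold {t} {s} D E e) = ⦂fold (⦂-swapT D) (⦂-swapT E) (trans (fvs-swapT s) (cong (map swapV) e))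

⦂⇒LocallyClosed : ∀ {t σ} → t ⦂ σ → LocallyClosed t
⦂⇒LocallyClosed ⦂var k u = refl
⦂⇒LocallyClosed ⦂con k u = refl
⦂⇒LocallyClosed (⦂lam {τ} {b = b} L f) k u =
  cong (lam τ) (openAt-fixed-before-openAt (suc k) 0 u (fresh L , τ) b (λ ())
    (⦂⇒LocallyClosed (f (fresh L) (fresh-∉ L τ)) (suc k) u))
⦂⇒LocallyClosed (⦂app D E _) k u = cong₂ app (⦂⇒LocallyClosed D k u) (⦂⇒LocallyClosed E k u)
⦂⇒LocallyClosed (⦂pair D E) k u = cong₂ pair (⦂⇒LocallyClosed D k u) (⦂⇒LocallyClosed E k u)
⦂⇒LocallyClosed (⦂fst D) k u = cong₂ app (⦂⇒LocallyClosed D k u) refl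
⦂⇒LocallyClosed (⦂snd D) k u = cong₂ app (⦂⇒LocallyClosed D k u) refl
⦂⇒LocallyClosed (⦂if D E F _) k u =
  cong₂ app (⦂⇒LocallyClosed D k u) (cong₂ pair (⦂⇒LocallyClosed E k u) (⦂⇒LocallyClosed F k u))
⦂⇒LocallyClosed (⦂let⊗ {r = r} {τ} {ρ} D L f _) k u =
  cong₂ app (⦂⇒LocallyClosed D k u) (cong (lam τ) (cong (lam ρ)
    (openAt-fixed-before-openAt (2 + k) 0 u (m , ρ) r (λ ())
      (openAt-fixed-before-openAt (2 + k) 1 u (n , τ) (openAt 0 (fvar (m , ρ)) r) (λ ())
        (⦂⇒LocallyClosed (f n m n∉ m∉ n≢m) (2 + k) u)))))
  where open Fresh₂ (fresh₂ L τ ρ)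
⦂⇒LocallyClosed (⦂fold D E _) k u =
  cong₂ app (⦂⇒LocallyClosed D k u) (cong brace (⦂⇒LocallyClosed E k u))

≋⇒⊇ : ∀ {Γ Δ} → Γ ≋ Δ → Δ ⊆ Γ
≋⇒⊇ eq p = proj₂ (eq _) p

⊗-body-fvs⊆ : ∀ {Γ x y} s → x ∉ fvs s → y ∉ fvs s → fvs (open₂ x y s) ⊆ x ∷ y ∷ Γ →
  fvs s ⊆ Γ
⊗-body-fvs⊆ {x = x} {y} s x∉ y∉ sub =
  ⊆.⊆∷∧∉⇒⊆ (⊆.⊆∷∧∉⇒⊆ (sub ∘ fvs-open₂⁺ x y s) x∉) y∉

⊢⇒fvs⊆ : ∀ {Γ t τ} → Γ ⊢ t ∶ τ → fvs t ⊆ Γ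
⊢⇒fvs⊆ (⊢var x∈Γ) (here refl) = x∈Γ
⊢⇒fvs⊆ (⊸⁺ {t = t} n n∉ D) = ⊆.⊆∷∧∉⇒⊆ (⊢⇒fvs⊆ D ∘ fvs-openAt⁺ 0 _ t) n∉
⊢⇒fvs⊆ (⊸⁻ _ eq D E) = ≋⇒⊇ eq ∘ ⊆.++⁺ (⊢⇒fvs⊆ D) (⊢⇒fvs⊆ E)
⊢⇒fvs⊆ (×⁺ D E) = ++-⊆ (⊢⇒fvs⊆ D) (⊢⇒fvs⊆ E)
⊢⇒fvs⊆ (×⁻₁ D) = ++-⊆ (⊢⇒fvs⊆ D) λ ()
⊢⇒fvs⊆ (×⁻₂ D) = ++-⊆ (⊢⇒fvs⊆ D) λ ()
⊢⇒fvs⊆ (𝐁⁻ _ eq D E F) =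
  ≋⇒⊇ eq ∘ ⊆.++⁺ (⊢⇒fvs⊆ D) (++-⊆ (⊢⇒fvs⊆ E) (⊢⇒fvs⊆ F))
⊢⇒fvs⊆ (⊗⁻ {s = s} _ _ _ eq _ _ _ n∉s m∉s D E) =
  ≋⇒⊇ eq ∘ ⊆.++⁺ (⊢⇒fvs⊆ D) (⊗-body-fvs⊆ s n∉s m∉s (⊢⇒fvs⊆ E))
⊢⇒fvs⊆ (𝐋⁻ D E) = ++-⊆ (⊢⇒fvs⊆ D) (≡[]⇒⊆ (⊆.⊆[]⇒≡[] (⊢⇒fvs⊆ E)))

⊢⇒⦂ : ∀ {Γ t τ} → Γ ⊢ t ∶ τ → t ⦂ τ
⊢⇒⦂ (⊢var _) = ⦂var
⊢⇒⦂ ⊢const = ⦂con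
⊢⇒⦂ (⊸⁺ {τ = τ} {ρ} {b} n n∉ D) = ⦂lam ((n , τ) ∷ fvs b) λ m m∉ →
  subst (_⦂ ρ) (Swap.swapT-rename τ n m 0 b n∉ (m∉ ∘ there)) (Swap.⦂-swapT τ n m (⊢⇒⦂ D))
⊢⇒⦂ (⊸⁻ dj _ D E) = ⦂app (⊢⇒⦂ D) (⊢⇒⦂ E) (Disjoint-mono (⊢⇒fvs⊆ D) (⊢⇒fvs⊆ E) dj)
⊢⇒⦂ (×⁺ D E) = ⦂pair (⊢⇒⦂ D) (⊢⇒⦂ E)
⊢⇒⦂ (×⁻₁ D) = ⦂fst (⊢⇒⦂ D)
⊢⇒⦂ (×⁻₂ D) = ⦂snd (⊢⇒⦂ D)
⊢⇒⦂ (𝐁⁻ dj _ D E F) =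
  ⦂if (⊢⇒⦂ D) (⊢⇒⦂ E) (⊢⇒⦂ F)
      (Disjoint-mono (⊢⇒fvs⊆ D) (++-⊆ (⊢⇒fvs⊆ E) (⊢⇒fvs⊆ F)) dj)
⊢⇒⦂ (⊗⁻ {s = s} {τ} {ρ} {σ} n m dj _ n≢m _ _ n∉s m∉s D E) =
  ⦂let⊗ (⊢⇒⦂ D) ((n , τ) ∷ (m , ρ) ∷ fvs s) renamed
    (Disjoint-mono (⊢⇒fvs⊆ D) (⊗-body-fvs⊆ s n∉s m∉s (⊢⇒fvs⊆ E)) dj)
  where
    renamed : ∀ n' m' → (n' , τ) ∉ (n , τ) ∷ (m , ρ) ∷ fvs s →
              (m' , ρ) ∉ (n , τ) ∷ (m , ρ) ∷ fvs s →
              (n' , τ) ≢ (m' , ρ) → open₂ (n' , τ) (m' , ρ) s ⦂ σ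
    renamed n' m' n'∉ m'∉ n'≢m' =
      subst (_⦂ σ) (Swap.swapT-open₂-renameʳ ρ m m' (n' , τ) s m∉s (m'∉ ∘ there ∘ there)
                      (n'∉ ∘ there ∘ here) n'≢m')
        (Swap.⦂-swapT ρ m m'
          (subst (_⦂ σ) (Swap.swapT-open₂-renameˡ τ n n' (m , ρ) s n∉s (n'∉ ∘ there ∘ there)
                           (n≢m ∘ sym) (n'∉ ∘ there ∘ here ∘ sym))
            (Swap.⦂-swapT τ n n' (⊢⇒⦂ E))))
⊢⇒⦂ (𝐋⁻ D E) = ⦂fold (⊢⇒⦂ D) (⊢⇒⦂ E) (⊆.⊆[]⇒≡[] (⊢⇒fvs⊆ E))

module Split (Γ A : Ctx) where

  Γ₁ Γ₂ : Ctx
  Γ₁ = filter (_∈? A) Γ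
  Γ₂ = filter (_∉? A) Γ

  disjoint : Disjoint Γ₁ Γ₂
  disjoint y p q = proj₂ (∈-filter⁻ (_∉? A) {xs = Γ} q) (proj₂ (∈-filter⁻ (_∈? A) {xs = Γ} p))

  ≋Γ₁++Γ₂ : Γ ≋ (Γ₁ ++ Γ₂)
  ≋Γ₁++Γ₂ y = to , ++-⊆ (proj₁ ∘ ∈-filter⁻ (_∈? A)) (proj₁ ∘ ∈-filter⁻ (_∉? A))
    where
      to : y ∈ Γ → y ∈ Γ₁ ++ Γ₂
      to p with y ∈? A
      ... | yes y∈A = ∈-++⁺ˡ (∈-filter⁺ (_∈? A) p y∈A)
      ... | no y∉A  = ∈-++⁺ʳ Γ₁ (∈-filter⁺ (_∉? A) p y∉A)

  ⊆Γ₁ : ∀ {B} → B ⊆ Γ → B ⊆ A → B ⊆ Γ₁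
  ⊆Γ₁ B⊆Γ B⊆A p = ∈-filter⁺ (_∈? A) (B⊆Γ p) (B⊆A p)

  ⊆Γ₂ : ∀ {B} → B ⊆ Γ → Disjoint A B → B ⊆ Γ₂
  ⊆Γ₂ B⊆Γ d p = ∈-filter⁺ (_∉? A) (B⊆Γ p) (λ q → d _ q p)

⦂⇒⊢ : ∀ {t τ} → t ⦂ τ → ∀ Γ → fvs t ⊆ Γ → Γ ⊢ t ∶ τ
⦂⇒⊢ ⦂var Γ sub = ⊢var (sub (here refl))
⦂⇒⊢ ⦂con Γ sub = ⊢const
⦂⇒⊢ (⦂lam {τ} {b = b} L f) Γ sub =
  ⊸⁺ n (n∉ ∘ ∈-++⁺ʳ L)
     (⦂⇒⊢ (f n (n∉ ∘ ∈-++⁺ˡ)) ((n , τ) ∷ Γ)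
          (⊆.++⁺ʳ _ sub ∘ fvs-openAt⁻ 0 (fvar (n , τ)) b))
  where
    n = fresh (L ++ fvs b)
    n∉ = fresh-∉ (L ++ fvs b) τ
⦂⇒⊢ (⦂app {t} D E d) Γ sub =
  ⊸⁻ disjoint ≋Γ₁++Γ₂ (⦂⇒⊢ D Γ₁ (⊆Γ₁ (sub ∘ ∈-++⁺ˡ) id))
     (⦂⇒⊢ E Γ₂ (⊆Γ₂ (sub ∘ ∈-++⁺ʳ (fvs t)) d))
  where open Split Γ (fvs t)
⦂⇒⊢ (⦂pair {t} D E) Γ sub =
  ×⁺ (⦂⇒⊢ D Γ (sub ∘ ∈-++⁺ˡ)) (⦂⇒⊢ E Γ (sub ∘ ∈-++⁺ʳ (fvs t)))
⦂⇒⊢ (⦂fst D) Γ sub = ×⁻₁ (⦂⇒⊢ D Γ (sub ∘ ∈-++⁺ˡ))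
⦂⇒⊢ (⦂snd D) Γ sub = ×⁻₂ (⦂⇒⊢ D Γ (sub ∘ ∈-++⁺ˡ))
⦂⇒⊢ (⦂if {t} {s} D E F d) Γ sub =
  𝐁⁻ disjoint ≋Γ₁++Γ₂ (⦂⇒⊢ D Γ₁ (⊆Γ₁ (sub ∘ ∈-++⁺ˡ) id))
     (⦂⇒⊢ E Γ₂ (⊆Γ₂ (sub ∘ ∈-++⁺ʳ (fvs t) ∘ ∈-++⁺ˡ) (Disjoint-mono id ∈-++⁺ˡ d)))
     (⦂⇒⊢ F Γ₂ (⊆Γ₂ (sub ∘ ∈-++⁺ʳ (fvs t) ∘ ∈-++⁺ʳ (fvs s))
                    (Disjoint-mono id (∈-++⁺ʳ (fvs s)) d)))
  where open Split Γ (fvs t)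
⦂⇒⊢ (⦂let⊗ {t} {r} {τ} {ρ} D L f d) Γ sub =
  ⊗⁻ n m disjoint ≋Γ₁++Γ₂ n≢m
     (n∉ ∘ ∈-++⁺ʳ L ∘ ∈-++⁺ʳ (fvs r)) (m∉ ∘ ∈-++⁺ʳ L ∘ ∈-++⁺ʳ (fvs r))
     (n∉ ∘ ∈-++⁺ʳ L ∘ ∈-++⁺ˡ) (m∉ ∘ ∈-++⁺ʳ L ∘ ∈-++⁺ˡ)
     (⦂⇒⊢ D Γ₁ (⊆Γ₁ (sub ∘ ∈-++⁺ˡ) id))
     (⦂⇒⊢ (f n m (n∉ ∘ ∈-++⁺ˡ) (m∉ ∘ ∈-++⁺ˡ) n≢m) _
        (⊆.++⁺ʳ (_ ∷ _ ∷ []) (⊆Γ₂ (sub ∘ ∈-++⁺ʳ (fvs t)) d)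
           ∘ fvs-open₂⁻ (n , τ) (m , ρ) r))
  where
    open Split Γ (fvs t)
    open Fresh₂ (fresh₂ (L ++ fvs r ++ Γ₂) τ ρ)
⦂⇒⊢ (⦂fold {s = s} D E e) Γ sub =
  𝐋⁻ (⦂⇒⊢ D Γ (sub ∘ ∈-++⁺ˡ)) (⦂⇒⊢ E [] (subst (fvs s ⊆_) e id))

⦂⇒Typable : ∀ {t τ} → t ⦂ τ → Typable t τ
⦂⇒Typable {t} D = fvs t , ⦂⇒⊢ D (fvs t) id

Typable⇒⦂ : ∀ {t τ} → Typable t τ → t ⦂ τ
Typable⇒⦂ (_ , D) = ⊢⇒⦂ D

Disjoint-openAt-var : ∀ {x S} k b → x ∉ S → Disjoint (fvs b) S → Disjoint (fvs (openAt k (fvar x) b)) S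
Disjoint-openAt-var {x} k b x∉ d = Disjoint-mono (fvs-openAt⁻ k (fvar x) b) id (Disjoint-∷ x∉ d)

Disjoint-open₂ : ∀ {x y S} r → x ∉ S → y ∉ S → Disjoint (fvs r) S → Disjoint (fvs (open₂ x y r)) S
Disjoint-open₂ {x} {y} r x∉ y∉ d =
  Disjoint-mono (fvs-open₂⁻ x y r) id (Disjoint-∷ x∉ (Disjoint-∷ y∉ d))

Disjoint-[≔] : ∀ x s t u → Disjoint (fvs t) (fvs u) → Disjoint (fvs t ++ fvs u) (fvs s) →
  Disjoint (fvs (t [ x ≔ s ])) (fvs (u [ x ≔ s ]))
Disjoint-[≔] x s t u d ds with x ∈? fvs t
... | yes x∈t rewrite [≔]-fresh x s u (d x x∈t) =
  Disjoint-mono (fvs-[≔] x s t) id (Disjoint-++ (Disjoint-sym (Disjoint-mono (∈-++⁺ʳ (fvs t)) id ds)) d)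
... | no x∉t rewrite [≔]-fresh x s t x∉t =
  Disjoint-sym (Disjoint-mono (fvs-[≔] x s u) id
    (Disjoint-++ (Disjoint-sym (Disjoint-mono ∈-++⁺ˡ id ds)) (Disjoint-sym d)))

⦂-[≔] : ∀ {t σ} x s → t ⦂ σ → s ⦂ vtype x → Disjoint (fvs t) (fvs s) → t [ x ≔ s ] ⦂ σ
⦂-[≔] x s (⦂var {y}) Ds d with y ≟ᵥ x
... | yes refl = Ds
... | no _     = ⦂var
⦂-[≔] x s ⦂con Ds d = ⦂con
⦂-[≔] x s (⦂lam {τ} {ρ} {b} L f) Ds d = ⦂lam (x ∷ L ++ fvs s) λ n n∉ →
  subst (_⦂ ρ) ([≔]-openAt-var x s 0 (n , τ) b (⦂⇒LocallyClosed Ds) (n∉ ∘ here))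
    (⦂-[≔] x s (f n (n∉ ∘ there ∘ ∈-++⁺ˡ)) Ds
       (Disjoint-openAt-var 0 b (n∉ ∘ there ∘ ∈-++⁺ʳ L) d))
⦂-[≔] x s (⦂app {t} {u} D E d) Ds ds =
  ⦂app (⦂-[≔] x s D Ds (Disjoint-mono ∈-++⁺ˡ id ds))
       (⦂-[≔] x s E Ds (Disjoint-mono (∈-++⁺ʳ (fvs t)) id ds))
       (Disjoint-[≔] x s t u d ds)
⦂-[≔] x s (⦂pair {t} D E) Ds ds =
  ⦂pair (⦂-[≔] x s D Ds (Disjoint-mono ∈-++⁺ˡ id ds))
        (⦂-[≔] x s E Ds (Disjoint-mono (∈-++⁺ʳ (fvs t)) id ds))
⦂-[≔] x s (⦂fst D) Ds ds = ⦂fst (⦂-[≔] x s D Ds (Disjoint-mono ∈-++⁺ˡ id ds))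
⦂-[≔] x s (⦂snd D) Ds ds = ⦂snd (⦂-[≔] x s D Ds (Disjoint-mono ∈-++⁺ˡ id ds))
⦂-[≔] x s (⦂if {t} {u} {r} D E F d) Ds ds =
  ⦂if (⦂-[≔] x s D Ds (Disjoint-mono ∈-++⁺ˡ id ds))
      (⦂-[≔] x s E Ds (Disjoint-mono (∈-++⁺ʳ (fvs t) ∘ ∈-++⁺ˡ) id ds))
      (⦂-[≔] x s F Ds (Disjoint-mono (∈-++⁺ʳ (fvs t) ∘ ∈-++⁺ʳ (fvs u)) id ds))
      (Disjoint-[≔] x s t (pair u r) d ds)
⦂-[≔] x s (⦂let⊗ {t} {r} {τ} {ρ} {σ} D L f d) Ds ds =
  ⦂let⊗ (⦂-[≔] x s D Ds (Disjoint-mono ∈-++⁺ˡ id ds)) (x ∷ L ++ fvs s) body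
        (Disjoint-[≔] x s t (lam τ (lam ρ r)) d ds)
  where
    body : ∀ n m → (n , τ) ∉ x ∷ L ++ fvs s → (m , ρ) ∉ x ∷ L ++ fvs s → (n , τ) ≢ (m , ρ) →
           open₂ (n , τ) (m , ρ) (r [ x ≔ s ]) ⦂ σ
    body n m n∉ m∉ n≢m =
      subst (_⦂ σ) ([≔]-open₂ x s (n , τ) (m , ρ) r (⦂⇒LocallyClosed Ds) (n∉ ∘ here) (m∉ ∘ here))
        (⦂-[≔] x s (f n m (n∉ ∘ there ∘ ∈-++⁺ˡ) (m∉ ∘ there ∘ ∈-++⁺ˡ) n≢m) Ds
           (Disjoint-open₂ r (n∉ ∘ there ∘ ∈-++⁺ʳ L) (m∉ ∘ there ∘ ∈-++⁺ʳ L)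
              (Disjoint-mono (∈-++⁺ʳ (fvs t)) id ds)))
⦂-[≔] x s (⦂fold {t} {u} D E e) Ds ds =
  subst (λ v → app (t [ x ≔ s ]) (brace v) ⦂ _) (sym ([≔]-fresh x s u (∉-≡[] e)))
    (⦂fold (⦂-[≔] x s D Ds (Disjoint-mono ∈-++⁺ˡ id ds)) E e)

+-excess : ∀ {a' b'} a b k → a' ≤ a + k → b' ≤ b → a' + b' ≤ (a + b) + k
+-excess a b k a'≤ b'≤ = ≤-trans (+-mono-≤ a'≤ b'≤) (≤-reflexive (xy∙z≈xz∙y a k b))

+-excessʳ : ∀ {b'} a b k → b' ≤ b + k → a + b' ≤ (a + b) + k
+-excessʳ a b k b'≤ = ≤-trans (+-monoʳ-≤ a b'≤) (≤-reflexive (sym (+-assoc a b k)))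

⊔-excess : ∀ {a' b'} a b k → a' ≤ a + k → b' ≤ b + k → a' ⊔ b' ≤ (a ⊔ b) + k
⊔-excess a b k a'≤ b'≤ = ≤-trans (⊔-mono-≤ a'≤ b'≤) (≤-reflexive (sym (+-distribʳ-⊔ k a b)))

X-factor≤X : ∀ n N g k → (n ⊓ N) * g + (n ⊓ N) * k ≤ N * g + N * k
X-factor≤X n N g k = +-mono-≤ (*-monoˡ-≤ g (m⊓n≤n n N)) (*-monoˡ-≤ k (m⊓n≤n n N))

size-[≔]-app : ∀ x s t u → Disjoint (fvs t) (fvs u) →
  size (t [ x ≔ s ]) ≤ size t + size s → size (u [ x ≔ s ]) ≤ size u + size s →
  size (app t u [ x ≔ s ]) ≤ size (app t u) + size s
size-[≔]-app x s t u d t≤ u≤ with x ∈? fvs t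
... | yes x∈t rewrite [≔]-fresh x s u (d x x∈t) = +-excess (size t) (size u) (size s) t≤ ≤-refl
... | no x∉t  rewrite [≔]-fresh x s t x∉t       = +-excessʳ (size t) (size u) (size s) u≤

size-[≔] : ∀ {t σ} x s → LocallyClosed s → t ⦂ σ → size (t [ x ≔ s ]) ≤ size t + size s
size-[≔] x s lc (⦂var {y}) with y ≟ᵥ x
... | yes _ = m≤n+m (size s) 1
... | no _  = m≤m+n 1 (size s)
size-[≔] x s lc ⦂con = m≤m+n 1 (size s)
size-[≔] x s lc (⦂lam {τ} {b = b} L f) = s≤s
  (subst₂ (λ p q → p ≤ q + size s)
     (trans (cong size ([≔]-openAt-var x s 0 (n , τ) b lc (n∉ ∘ here)))
            (size-openAt-var 0 (n , τ) (b [ x ≔ s ])))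
     (size-openAt-var 0 (n , τ) b)
     (size-[≔] x s lc (f n (n∉ ∘ there))))
  where
    n = fresh (x ∷ L)
    n∉ = fresh-∉ (x ∷ L) τ
size-[≔] x s lc (⦂app {t} {u} D E d) = size-[≔]-app x s t u d (size-[≔] x s lc D) (size-[≔] x s lc E)
size-[≔] x s lc (⦂pair {t} {u} D E) =
  s≤s (⊔-excess (size t) (size u) (size s) (size-[≔] x s lc D) (size-[≔] x s lc E))
size-[≔] x s lc (⦂fst {t} D) =
  size-[≔]-app x s t (con tt) (λ _ _ ()) (size-[≔] x s lc D) (m≤m+n 1 (size s))
size-[≔] x s lc (⦂snd {t} D) =
  size-[≔]-app x s t (con ff) (λ _ _ ()) (size-[≔] x s lc D) (m≤m+n 1 (size s))
size-[≔] x s lc (⦂if {t} {u} {r} D E F d) = size-[≔]-app x s t (pair u r) d (size-[≔] x s lc D)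
  (s≤s (⊔-excess (size u) (size r) (size s) (size-[≔] x s lc E) (size-[≔] x s lc F)))
size-[≔] x s lc (⦂let⊗ {t} {r} {τ} {ρ} D L f d) =
  size-[≔]-app x s t (lam τ (lam ρ r)) d (size-[≔] x s lc D)
  (s≤s (s≤s (subst₂ (λ p q → p ≤ q + size s)
     (trans (cong size ([≔]-open₂ x s (n , τ) (m , ρ) r lc (n∉ ∘ here) (m∉ ∘ here)))
            (size-open₂ (n , τ) (m , ρ) (r [ x ≔ s ])))
     (size-open₂ (n , τ) (m , ρ) r)
     (size-[≔] x s lc (f n m (n∉ ∘ there) (m∉ ∘ there) n≢m)))))
  where open Fresh₂ (fresh₂ (x ∷ L) τ ρ)
size-[≔] x s lc (⦂fold {t} {u} D E e) =
  size-[≔]-app x s t (brace u) (λ _ _ → ∉-≡[] e) (size-[≔] x s lc D) z≤n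

module βContractum {τ ρ s} (b : Term) (L : List Var)
                   (f : ∀ n → (n , τ) ∉ L → openAt 0 (fvar (n , τ)) b ⦂ ρ)
                   (Ds : s ⦂ τ) (d : Disjoint (fvs b) (fvs s)) where

  private
    n∉ = fresh-∉ (L ++ fvs b ++ fvs s) τ

  x : Var
  x = fresh (L ++ fvs b ++ fvs s) , τ

  body⦂ : openAt 0 (fvar x) b ⦂ ρ
  body⦂ = f _ (n∉ ∘ ∈-++⁺ˡ)

  body-disjoint : Disjoint (fvs (openAt 0 (fvar x) b)) (fvs s)
  body-disjoint = Disjoint-openAt-var 0 b (n∉ ∘ ∈-++⁺ʳ L ∘ ∈-++⁺ʳ (fvs b)) d

  x∉b : x ∉ fvs b
  x∉b = n∉ ∘ ∈-++⁺ʳ L ∘ ∈-++⁺ˡ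

  as-[≔] : openAt 0 (fvar x) b [ x ≔ s ] ≡ openAt 0 s b
  as-[≔] = [≔]-openAt-self x s 0 b (⦂⇒LocallyClosed Ds) x∉b

  result⦂ : openAt 0 s b ⦂ ρ
  result⦂ = subst (_⦂ ρ) as-[≔] (⦂-[≔] x s body⦂ Ds body-disjoint)

  size-result : size (openAt 0 s b) ≤ size b + size s
  size-result = subst₂ (λ p q → p ≤ q + size s) (cong size as-[≔]) (size-openAt-var 0 x b)
                  (size-[≔] x s (⦂⇒LocallyClosed Ds) body⦂)

module ⊗Contractum {τ ρ σ t s} (r : Term) (Dt : t ⦂ τ) (Ds : s ⦂ ρ) (L : List Var)
  (f : ∀ n m → (n , τ) ∉ L → (m , ρ) ∉ L → (n , τ) ≢ (m , ρ) → open₂ (n , τ) (m , ρ) r ⦂ σ)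
  (dts : Disjoint (fvs t) (fvs s)) (d : Disjoint (fvs t ++ fvs s) (fvs r)) where

  open Fresh₂ (fresh₂ (L ++ fvs r ++ fvs s ++ fvs t) τ ρ) public

  x y : Var
  x = n , τ
  y = m , ρ

  x∉r : x ∉ fvs r
  x∉r = n∉ ∘ ∈-++⁺ʳ L ∘ ∈-++⁺ˡ

  y∉r : y ∉ fvs r
  y∉r = m∉ ∘ ∈-++⁺ʳ L ∘ ∈-++⁺ˡ

  private
    x∉s : x ∉ fvs s
    x∉s = n∉ ∘ ∈-++⁺ʳ L ∘ ∈-++⁺ʳ (fvs r) ∘ ∈-++⁺ˡ
    y∉s : y ∉ fvs s
    y∉s = m∉ ∘ ∈-++⁺ʳ L ∘ ∈-++⁺ʳ (fvs r) ∘ ∈-++⁺ˡ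
    x∉t : x ∉ fvs t
    x∉t = n∉ ∘ ∈-++⁺ʳ L ∘ ∈-++⁺ʳ (fvs r) ∘ ∈-++⁺ʳ (fvs s)
    y∉t : y ∉ fvs t
    y∉t = m∉ ∘ ∈-++⁺ʳ L ∘ ∈-++⁺ʳ (fvs r) ∘ ∈-++⁺ʳ (fvs s)

  body : Term
  body = open₂ x y r

  body⦂ : body ⦂ σ
  body⦂ = f n m (n∉ ∘ ∈-++⁺ˡ) (m∉ ∘ ∈-++⁺ˡ) n≢m

  body-disjoint : Disjoint (fvs body) (fvs s)
  body-disjoint = Disjoint-open₂ r x∉s y∉s (Disjoint-sym (Disjoint-mono (∈-++⁺ʳ (fvs t)) id d))

  body' : Term
  body' = body [ y ≔ s ]

  body'⦂ : body' ⦂ σ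
  body'⦂ = ⦂-[≔] y s body⦂ Ds body-disjoint

  body'-disjoint : Disjoint (fvs body') (fvs t)
  body'-disjoint = Disjoint-mono (fvs-[≔] y s body) id
    (Disjoint-++ (Disjoint-sym dts) (Disjoint-open₂ r x∉t y∉t (Disjoint-sym (Disjoint-mono ∈-++⁺ˡ id d))))

  as-[≔] : body' [ x ≔ t ] ≡ openAt 1 t (openAt 0 s r)
  as-[≔] = begin
    body' [ x ≔ t ]                              ≡⟨ cong (_[ x ≔ t ]) body'-as-open ⟩
    openAt 1 (fvar x) (openAt 0 s r) [ x ≔ t ]
      ≡⟨ [≔]-openAt-self x t 1 (openAt 0 s r) (⦂⇒LocallyClosed Dt)
           ([ x∉s , x∉r ] ∘ ∈-++⁻ (fvs s) ∘ fvs-openAt⁻ 0 s r) ⟩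
    openAt 1 t (openAt 0 s r)                    ∎
    where
      open ≡-Reasoning
      body'-as-open : body' ≡ openAt 1 (fvar x) (openAt 0 s r)
      body'-as-open = trans ([≔]-openAt-var y s 1 x (openAt 0 (fvar y) r) (⦂⇒LocallyClosed Ds) n≢m)
                            (cong (openAt 1 (fvar x)) ([≔]-openAt-self y s 0 r (⦂⇒LocallyClosed Ds) y∉r))

  result⦂ : openAt 1 t (openAt 0 s r) ⦂ σ
  result⦂ = subst (_⦂ σ) as-[≔] (⦂-[≔] x t body'⦂ Dt body'-disjoint)

  size-result : size (openAt 1 t (openAt 0 s r)) ≤ (size r + size s) + size t
  size-result = begin
    size (openAt 1 t (openAt 0 s r))  ≡⟨ cong size (sym as-[≔]) ⟩
    size (body' [ x ≔ t ])            ≤⟨ size-[≔] x t (⦂⇒LocallyClosed Dt) body'⦂ ⟩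
    size body' + size t
      ≤⟨ +-monoˡ-≤ (size t) (size-[≔] y s (⦂⇒LocallyClosed Ds) body⦂) ⟩
    (size body + size s) + size t     ≡⟨ cong (λ k → (k + size s) + size t) (size-open₂ x y r) ⟩
    (size r + size s) + size t        ∎
    where open ≤-Reasoning

data Arrow : Ty → Set where
  ⊸-arrow : ∀ {τ ρ} → Arrow (τ ⊸ ρ)

app-inv-arrow-head : ∀ {t s σ} → (∀ {σ'} → t ⦂ σ' → Arrow σ') → app t s ⦂ σ →
  ∃[ α ] (t ⦂ α ⊸ σ × s ⦂ α × Disjoint (fvs t) (fvs s))
app-inv-arrow-head arrow (⦂app D E d) = _ , D , E , d
app-inv-arrow-head arrow (⦂fst D) with arrow D
... | ()
app-inv-arrow-head arrow (⦂snd D) with arrow D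
... | ()
app-inv-arrow-head arrow (⦂if D _ _ _) with arrow D
... | ()
app-inv-arrow-head arrow (⦂let⊗ D _ _ _) with arrow D
... | ()
app-inv-arrow-head arrow (⦂fold D _ _) with arrow D
... | ()

≡⊸⇒Arrow : ∀ {σ τ ρ} → σ ≡ τ ⊸ ρ → Arrow σ
≡⊸⇒Arrow refl = ⊸-arrow

cons-app₁-inv : ∀ {τ d σ} → app (con (cons τ)) d ⦂ σ → σ ≡ τ ⊸ 𝐋 τ ⊸ 𝐋 τ × d ⦂ ◇
cons-app₁-inv D with app-inv-arrow-head (λ { ⦂con → ⊸-arrow }) D
... | _ , ⦂con , Dd , _ = refl , Dd

cons-app₂-inv : ∀ {τ d a σ} → app (app (con (cons τ)) d) a ⦂ σ →
  σ ≡ 𝐋 τ ⊸ 𝐋 τ × d ⦂ ◇ × a ⦂ τ × Disjoint (fvs d) (fvs a)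
cons-app₂-inv D with app-inv-arrow-head (≡⊸⇒Arrow ∘ proj₁ ∘ cons-app₁-inv) D
... | _ , Dh , Da , d with cons-app₁-inv Dh
...   | refl , Dd = refl , Dd , Da , d

cons-app₃-inv : ∀ {τ d a ℓ σ} → app (app (app (con (cons τ)) d) a) ℓ ⦂ σ →
  σ ≡ 𝐋 τ × d ⦂ ◇ × a ⦂ τ × ℓ ⦂ 𝐋 τ ×
  Disjoint (fvs d) (fvs a) × Disjoint (fvs d ++ fvs a) (fvs ℓ)
cons-app₃-inv D with app-inv-arrow-head (≡⊸⇒Arrow ∘ proj₁ ∘ cons-app₂-inv) D
... | _ , Dh , Dℓ , d with cons-app₂-inv Dh
...   | refl , Dd , Da , d' = refl , Dd , Da , Dℓ , d' , d

tens-app₁-inv : ∀ {τ ρ t σ} → app (con (tens τ ρ)) t ⦂ σ → σ ≡ ρ ⊸ τ ⊗ ρ × t ⦂ τ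
tens-app₁-inv D with app-inv-arrow-head (λ { ⦂con → ⊸-arrow }) D
... | _ , ⦂con , Dt , _ = refl , Dt

tens-app₂-inv : ∀ {τ ρ t s σ} → app (app (con (tens τ ρ)) t) s ⦂ σ →
  σ ≡ τ ⊗ ρ × t ⦂ τ × s ⦂ ρ × Disjoint (fvs t) (fvs s)
tens-app₂-inv D with app-inv-arrow-head (≡⊸⇒Arrow ∘ proj₁ ∘ tens-app₁-inv) D
... | _ , Dh , Ds , d with tens-app₁-inv Dh
...   | refl , Dt = refl , Dt , Ds , d

brace-app-Arrow : ∀ {ℓ h σ} → app ℓ (brace h) ⦂ σ → Arrow σ
brace-app-Arrow (⦂app _ () _)
brace-app-Arrow (⦂fold _ _ _) = ⊸-arrow

fold-app-inv : ∀ {ℓ h s σ} → app (app ℓ (brace h)) s ⦂ σ →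
  ∃[ τ ] (ℓ ⦂ 𝐋 τ × h ⦂ ◇ ⊸ τ ⊸ σ ⊸ σ × fvs h ≡ [] × s ⦂ σ ×
          Disjoint (fvs ℓ ++ fvs h) (fvs s))
fold-app-inv D with app-inv-arrow-head brace-app-Arrow D
... | _ , ⦂fold Dℓ Dh e , Ds , d = _ , Dℓ , Dh , e , Ds , d
... | _ , ⦂app _ () _ , _ , _

fvs-↦ : ∀ {t t'} → t ↦ t' → fvs t' ⊆ fvs t
fvs-↦ (β {t = b} {s}) =
  ++-⊆ (⊆.xs⊆ys++xs (fvs s) (fvs b)) (⊆.xs⊆xs++ys (fvs b) (fvs s)) ∘ fvs-openAt⁻ 0 s b
fvs-↦ π₁ = ∈-++⁺ˡ ∘ ∈-++⁺ˡ
fvs-↦ (π₂ {t}) = ∈-++⁺ˡ ∘ ∈-++⁺ʳ (fvs t)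
fvs-↦ if-tt = ∈-++⁺ˡ
fvs-↦ (if-ff {t}) = ∈-++⁺ʳ (fvs t)
fvs-↦ (⊗-conv {t = t} {s} {r}) =
  ++-⊆ (∈-++⁺ˡ ∘ ∈-++⁺ˡ)
       (++-⊆ (∈-++⁺ˡ ∘ ∈-++⁺ʳ (fvs t)) (∈-++⁺ʳ (fvs t ++ fvs s)) ∘ fvs-openAt⁻ 0 s r)
    ∘ fvs-openAt⁻ 1 t (openAt 0 s r)
fvs-↦ (nil-conv {t = t}) = ∈-++⁺ʳ (fvs t)
fvs-↦ (cons-conv {d = d} {a} {ℓ} {t} {s} _) =
  ++-⊆ (++-⊆ (++-⊆ t⊆ d⊆) a⊆) (++-⊆ (++-⊆ ℓ⊆ t⊆) s⊆)
  where
    redex = (((fvs d ++ fvs a) ++ fvs ℓ) ++ fvs t) ++ fvs s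
    t⊆ : fvs t ⊆ redex
    t⊆ = ∈-++⁺ˡ ∘ ∈-++⁺ʳ ((fvs d ++ fvs a) ++ fvs ℓ)
    d⊆ : fvs d ⊆ redex
    d⊆ = ∈-++⁺ˡ ∘ ∈-++⁺ˡ ∘ ∈-++⁺ˡ ∘ ∈-++⁺ˡ
    a⊆ : fvs a ⊆ redex
    a⊆ = ∈-++⁺ˡ ∘ ∈-++⁺ˡ ∘ ∈-++⁺ˡ ∘ ∈-++⁺ʳ (fvs d)
    ℓ⊆ : fvs ℓ ⊆ redex
    ℓ⊆ = ∈-++⁺ˡ ∘ ∈-++⁺ˡ ∘ ∈-++⁺ʳ (fvs d ++ fvs a)
    s⊆ : fvs s ⊆ redex
    s⊆ = ∈-++⁺ʳ (((fvs d ++ fvs a) ++ fvs ℓ) ++ fvs t)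

fvs-⟶ : ∀ {t t'} → t ⟶ t' → fvs t' ⊆ fvs t
fvs-⟶ (conv c) = fvs-↦ c
fvs-⟶ (appˡ r) = ⊆.++⁺ (fvs-⟶ r) id
fvs-⟶ (appʳ {t} r) = ⊆.++⁺ʳ (fvs t) (fvs-⟶ r)

⦂-↦ : ∀ {t t' σ} → t ↦ t' → t ⦂ σ → t' ⦂ σ
⦂-↦ (β {t = b}) (⦂app (⦂lam L f) Ds d) = βContractum.result⦂ b L f Ds d
⦂-↦ π₁ (⦂fst (⦂pair D _)) = D
⦂-↦ π₁ (⦂app () _ _)
⦂-↦ π₂ (⦂snd (⦂pair _ E)) = E
⦂-↦ π₂ (⦂app () _ _)
⦂-↦ if-tt (⦂if _ E _ _) = E
⦂-↦ if-tt (⦂app () _ _)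
⦂-↦ if-ff (⦂if _ _ F _) = F
⦂-↦ if-ff (⦂app () _ _)
⦂-↦ (⊗-conv {r = r}) (⦂let⊗ D L f d) with tens-app₂-inv D
... | refl , Dt , Ds , dts = ⊗Contractum.result⦂ r Dt Ds L f dts d
⦂-↦ ⊗-conv (⦂app D _ _) with tens-app₂-inv D
... | () , _
⦂-↦ nil-conv D with fold-app-inv D
... | _ , _ , _ , _ , Ds , _ = Ds
⦂-↦ (cons-conv {d = d} {a} {ℓ} {t} {s} _) D with fold-app-inv D
... | _ , Dcons , Dt , e , Ds , dj with cons-app₃-inv Dcons
...   | refl , Dd , Da , Dℓ , dda , ddaℓ =
  ⦂app (⦂app (⦂app Dt Dd (Disjoint-≡[]ˡ e)) Da (Disjoint-++ (Disjoint-≡[]ˡ e) dda))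
       (⦂app (⦂fold Dℓ Dt e) Ds (Disjoint-++ ℓ#s (Disjoint-≡[]ˡ e)))
       (Disjoint-mono tda⊆da ℓts⊆ℓs (Disjoint-++ʳ ddaℓ da#s))
  where
    da#s : Disjoint (fvs d ++ fvs a) (fvs s)
    da#s = Disjoint-mono (∈-++⁺ˡ ∘ ∈-++⁺ˡ) id dj
    ℓ#s : Disjoint (fvs ℓ) (fvs s)
    ℓ#s = Disjoint-mono (∈-++⁺ˡ ∘ ∈-++⁺ʳ (fvs d ++ fvs a)) id dj
    tda⊆da : (fvs t ++ fvs d) ++ fvs a ⊆ fvs d ++ fvs a
    tda⊆da = ++-⊆ (++-⊆ (≡[]⇒⊆ e) ∈-++⁺ˡ) (∈-++⁺ʳ (fvs d))
    ℓts⊆ℓs : (fvs ℓ ++ fvs t) ++ fvs s ⊆ fvs ℓ ++ fvs s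
    ℓts⊆ℓs = ++-⊆ (++-⊆ ∈-++⁺ˡ (≡[]⇒⊆ e)) (∈-++⁺ʳ (fvs ℓ))

⦂-⟶ : ∀ {t t' σ} → t ⟶ t' → t ⦂ σ → t' ⦂ σ
⦂-⟶ (conv c) D = ⦂-↦ c D
⦂-⟶ (appˡ r) (⦂app D E d)       = ⦂app (⦂-⟶ r D) E (Disjoint-mono (fvs-⟶ r) id d)
⦂-⟶ (appˡ r) (⦂fst D)           = ⦂fst (⦂-⟶ r D)
⦂-⟶ (appˡ r) (⦂snd D)           = ⦂snd (⦂-⟶ r D)
⦂-⟶ (appˡ r) (⦂if D E F d)      = ⦂if (⦂-⟶ r D) E F (Disjoint-mono (fvs-⟶ r) id d)
⦂-⟶ (appˡ r) (⦂let⊗ D L f d)    = ⦂let⊗ (⦂-⟶ r D) L f (Disjoint-mono (fvs-⟶ r) id d)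
⦂-⟶ (appˡ r) (⦂fold D E e)      = ⦂fold (⦂-⟶ r D) E e
⦂-⟶ (appʳ r) (⦂app D E d)       = ⦂app D (⦂-⟶ r E) (Disjoint-mono id (fvs-⟶ r) d)
⦂-⟶ (appʳ (conv ())) (⦂fst _)
⦂-⟶ (appʳ (conv ())) (⦂snd _)
⦂-⟶ (appʳ (conv ())) (⦂if _ _ _ _)
⦂-⟶ (appʳ (conv ())) (⦂let⊗ _ _ _ _)
⦂-⟶ (appʳ (conv ())) (⦂fold _ _ _)

Typable-⟶ : ∀ {a a' τ} → Typable a τ → a ⟶ a' → Typable a' τ
Typable-⟶ Da r = ⦂⇒Typable (⦂-⟶ r (Typable⇒⦂ Da))

IsListOf-length-unique : ∀ {τ τ' n m t} → IsListOf τ n t → IsListOf τ' m t → n ≡ m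
IsListOf-length-unique lnil lnil = refl
IsListOf-length-unique (lcons _ _ il) (lcons _ _ il') = cong suc (IsListOf-length-unique il il')

IsListOf-type : ∀ {τ n ℓ σ} → ℓ ⦂ σ → IsListOf τ n ℓ → σ ≡ 𝐋 τ
IsListOf-type ⦂con lnil = refl
IsListOf-type D (lcons _ _ _) = proj₁ (cons-app₃-inv D)

IsListOf-⟶ : ∀ {τ n t t'} → IsListOf τ n t → t ⟶ t' → IsListOf τ n t'
IsListOf-⟶ (lcons Dd Da il) (appʳ r)               = lcons Dd Da (IsListOf-⟶ il r)
IsListOf-⟶ (lcons Dd Da il) (appˡ (appʳ r))        = lcons Dd (Typable-⟶ Da r) il
IsListOf-⟶ (lcons Dd Da il) (appˡ (appˡ (appʳ r))) = lcons (Typable-⟶ Dd r) Da il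
IsListOf-⟶ lnil (conv ())
IsListOf-⟶ (lcons _ _ _) (conv ())
IsListOf-⟶ (lcons _ _ _) (appˡ (conv ()))
IsListOf-⟶ (lcons _ _ _) (appˡ (appˡ (conv ())))
IsListOf-⟶ (lcons _ _ _) (appˡ (appˡ (appˡ (conv ()))))

IsListOf-[≔] : ∀ {τ n ℓ} x s → IsListOf τ n ℓ → s ⦂ vtype x → Disjoint (fvs ℓ) (fvs s) →
  IsListOf τ n (ℓ [ x ≔ s ])
IsListOf-[≔] x s lnil Ds d = lnil
IsListOf-[≔] x s (lcons {d = e} {a} De Da il) Ds d =
  lcons (⦂⇒Typable (⦂-[≔] x s (Typable⇒⦂ De) Ds (Disjoint-mono (∈-++⁺ˡ ∘ ∈-++⁺ˡ) id d)))
        (⦂⇒Typable (⦂-[≔] x s (Typable⇒⦂ Da) Ds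
                      (Disjoint-mono (∈-++⁺ˡ ∘ ∈-++⁺ʳ (fvs e)) id d)))
        (IsListOf-[≔] x s il Ds (Disjoint-mono (∈-++⁺ʳ (fvs e ++ fvs a)) id d))

data ListView : Term → Set where
  nil-view  : ∀ τ → ListView (con (nil τ))
  cons-view : ∀ τ d a ℓ → ListView (app (app (app (con (cons τ)) d) a) ℓ)
  other     : ∀ {t} → ListView t

listView : ∀ t → ListView t
listView (con (nil τ))                           = nil-view τ
listView (app (app (app (con (cons τ)) d) a) ℓ) = cons-view τ d a ℓ
listView t                                       = other

IsListOf⇒view≢other : ∀ {τ n t} → IsListOf τ n t → listView t ≢ other
IsListOf⇒view≢other lnil ()
IsListOf⇒view≢other (lcons _ _ _) ()

isList? : ∀ t {σ} → t ⦂ σ → Dec (∃[ n ] IsList n t)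
isList? t D with listView t in eq
... | nil-view τ = yes (0 , τ , lnil)
... | other      = no λ { (_ , _ , il) → IsListOf⇒view≢other il eq }
... | cons-view τ d a ℓ with cons-app₃-inv D
...   | refl , Dd , Da , Dℓ , _ with isList? ℓ Dℓ
...     | no ¬list = no λ { (suc n , _ , lcons _ _ il) → ¬list (n , _ , il) }
...     | yes (n , τ' , il) with IsListOf-type Dℓ il
...       | refl = yes (suc n , τ , lcons (⦂⇒Typable Dd) (⦂⇒Typable Da) il)

module _ (τ : Ty) (a b : ℕ) where
  open Swap τ a b

  IsListOf-swapT : ∀ {σ n t} → IsListOf σ n t → IsListOf σ n (swapT t)
  IsListOf-swapT lnil = lnil
  IsListOf-swapT (lcons Dd Da il) =
    lcons (⦂⇒Typable (⦂-swapT (Typable⇒⦂ Dd))) (⦂⇒Typable (⦂-swapT (Typable⇒⦂ Da)))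
          (IsListOf-swapT il)

  Πb-swapT : ∀ {t f} → Πb t f → Πb (swapT t) f
  Πb-swapT πvar   = πvar
  Πb-swapT πbvar  = πbvar
  Πb-swapT πconst = πconst
  Πb-swapT (πlam {σ} {t} {f} n n∉ P) =
    πlam _ (∉-fvs-swapT t n∉) (subst (λ u → Πb u f) (swapT-openAt 0 (fvar (n , σ)) t) (Πb-swapT P))
  Πb-swapT (πpair P Q) = πpair (Πb-swapT P) (Πb-swapT Q)
  Πb-swapT (πbrace {h} {g} P) =
    subst (Πb (brace (swapT h))) (cong (λ k N → N * g N + N * k) (size-swapT h)) (πbrace (Πb-swapT P))
  Πb-swapT (πappL {t} {h} {n} {f} {g} (σ , il) P Q) =
    subst (Πb (app (swapT t) (brace (swapT h))))
          (cong (λ k N → f N + (n ⊓ N) * g N + (n ⊓ N) * k) (size-swapT h))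
      (πappL (σ , IsListOf-swapT il) (Πb-swapT P) (Πb-swapT Q))
  Πb-swapT (πapp {t} {s} ¬list P Q) = πapp ¬list' (Πb-swapT P) (Πb-swapT Q)
    where
      ¬list' : ¬ (∃[ n ] ∃[ h ] (IsList n (swapT t) × swapT s ≡ brace h))
      ¬list' (n , h , (σ , il) , e) =
        ¬list (n , swapT h , (σ , subst (IsListOf σ n) (swapT-involutive t) (IsListOf-swapT il)) ,
               trans (sym (swapT-involutive s)) (cong swapT e))

Πb-openAt-rename : ∀ {f} b n m τ → (n , τ) ∉ fvs b → (m , τ) ∉ fvs b →
  Πb (openAt 0 (fvar (n , τ)) b) f → Πb (openAt 0 (fvar (m , τ)) b) f
Πb-openAt-rename {f} b n m τ n∉ m∉ P =
  subst (λ u → Πb u f) (Swap.swapT-rename τ n m 0 b n∉ m∉) (Πb-swapT τ n m P)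

Πb-lam-inv : ∀ {τ b f} → Πb (lam τ b) f → ∀ k → (k , τ) ∉ fvs b →
  Πb (openAt 0 (fvar (k , τ)) b) f
Πb-lam-inv {b = b} (πlam n n∉ P) k k∉ = Πb-openAt-rename b n k _ n∉ k∉ P

Πb-lam₂-inv : ∀ {τ ρ r f} → Πb (lam τ (lam ρ r)) f →
  ∀ n m → (n , τ) ∉ fvs r → (m , ρ) ∉ fvs r →
  (n , τ) ≢ (m , ρ) → Πb (open₂ (n , τ) (m , ρ) r) f
Πb-lam₂-inv {τ} {ρ} {r} {f} P n m n∉ m∉ n≢m =
  subst (λ u → Πb u f) (sym (openAt-comm 1 0 (n , τ) (m , ρ) r (λ ())))
    (Πb-lam-inv (Πb-lam-inv P n n∉) m m∉open)
  where
    m∉open : (m , ρ) ∉ fvs (openAt 1 (fvar (n , τ)) r)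
    m∉open p with fvs-openAt⁻ 1 (fvar (n , τ)) r p
    ... | here e  = n≢m (sym e)
    ... | there q = m∉ q

Πb-functional : ∀ {t f g} → Πb t f → Πb t g → ∀ N → f N ≡ g N
Πb-functional πvar   πvar   N = refl
Πb-functional πbvar  πbvar  N = refl
Πb-functional πconst πconst N = refl
Πb-functional (πlam {τ} {b} n n∉ P) (πlam m m∉ Q) N =
  Πb-functional P (Πb-openAt-rename b m n τ m∉ n∉ Q) N
Πb-functional (πpair P Q) (πpair P' Q') N = cong₂ _⊔_ (Πb-functional P P' N) (Πb-functional Q Q' N)
Πb-functional (πbrace {h} P) (πbrace P') N = cong (λ k → N * k + N * size h) (Πb-functional P P' N)
Πb-functional (πappL {h = h} {n} (_ , il) P Q) (πappL (_ , il') P' Q') N with IsListOf-length-unique il il'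
... | refl = cong₂ (λ k l → k + (n ⊓ N) * l + (n ⊓ N) * size h)
                  (Πb-functional P P' N) (Πb-functional Q Q' N)
Πb-functional (πappL {h = h} {n} il _ _) (πapp ¬list _ _) N = ⊥-elim (¬list (n , h , il , refl))
Πb-functional (πapp ¬list _ _) (πappL {h = h} {n} il _ _) N = ⊥-elim (¬list (n , h , il , refl))
Πb-functional (πapp _ P Q) (πapp _ P' Q') N = cong₂ _+_ (Πb-functional P P' N) (Πb-functional Q Q' N)

⦂⇒≢brace : ∀ {s h τ} → s ⦂ τ → s ≢ brace h
⦂⇒≢brace () refl

Πb-exists : ∀ {t σ} → t ⦂ σ → ∃ (Πb t)
Πb-exists ⦂var = _ , πvar
Πb-exists ⦂con = _ , πconst
Πb-exists (⦂lam {τ} {b = b} L f) =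
  _ , πlam n (n∉ ∘ ∈-++⁺ʳ L) (proj₂ (Πb-exists (f n (n∉ ∘ ∈-++⁺ˡ))))
  where
    n = fresh (L ++ fvs b)
    n∉ = fresh-∉ (L ++ fvs b) τ
Πb-exists (⦂app D E _) =
  _ , πapp (λ { (_ , _ , _ , e) → ⦂⇒≢brace E e }) (proj₂ (Πb-exists D)) (proj₂ (Πb-exists E))
Πb-exists (⦂pair D E) = _ , πpair (proj₂ (Πb-exists D)) (proj₂ (Πb-exists E))
Πb-exists (⦂fst D) = _ , πapp (λ { (_ , _ , _ , ()) }) (proj₂ (Πb-exists D)) πconst
Πb-exists (⦂snd D) = _ , πapp (λ { (_ , _ , _ , ()) }) (proj₂ (Πb-exists D)) πconst
Πb-exists (⦂if D E F _) =
  _ , πapp (λ { (_ , _ , _ , ()) }) (proj₂ (Πb-exists D))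
           (πpair (proj₂ (Πb-exists E)) (proj₂ (Πb-exists F)))
Πb-exists (⦂let⊗ {r = r} {τ} {ρ} D L f _) =
  _ , πapp (λ { (_ , _ , _ , ()) }) (proj₂ (Πb-exists D))
        (πlam n (n∉ ∘ ∈-++⁺ʳ L) (πlam m m∉open
          (subst (λ u → Πb u (proj₁ body)) (openAt-comm 1 0 (n , τ) (m , ρ) r (λ ())) (proj₂ body))))
  where
    open Fresh₂ (fresh₂ (L ++ fvs r) τ ρ)
    body = Πb-exists (f n m (n∉ ∘ ∈-++⁺ˡ) (m∉ ∘ ∈-++⁺ˡ) n≢m)
    m∉open : (m , ρ) ∉ fvs (openAt 1 (fvar (n , τ)) r)
    m∉open p with fvs-openAt⁻ 1 (fvar (n , τ)) r p
    ... | here e  = n≢m (sym e)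
    ... | there q = m∉ (∈-++⁺ʳ L q)
Πb-exists (⦂fold {t} D E _) with isList? t D
... | yes (n , il) = _ , πappL il (proj₂ (Πb-exists D)) (proj₂ (Πb-exists E))
... | no ¬list     =
  _ , πapp (λ { (n , _ , il , refl) → ¬list (n , il) })
           (proj₂ (Πb-exists D)) (πbrace (proj₂ (Πb-exists E)))

Πb-app-inv : ∀ {t u h} → Πb (app t u) h → (∀ v → u ≢ brace v) →
  ∃₂ λ f g → Πb t f × Πb u g × (∀ N → h N ≡ f N + g N)
Πb-app-inv (πappL _ _ _) ¬brace = ⊥-elim (¬brace _ refl)
Πb-app-inv (πapp _ P Q) ¬brace = _ , _ , P , Q , λ N → refl

module Πb-[≔] (N : ℕ) {g : ℕ → ℕ} (x : Var) (s : Term) (Ds : s ⦂ vtype x) (Pg : Πb s g) where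

  Excess : Term → Set
  Excess t = ∀ {f h} → Πb t f → Πb (t [ x ≔ s ]) h → h N ≤ f N + g N

  app-excess : ∀ {t u} → Disjoint (fvs t) (fvs u) →
    (∀ v → u ≢ brace v) → (∀ v → u [ x ≔ s ] ≢ brace v) → Excess t → Excess u → Excess (app t u)
  app-excess {t} {u} d u≢brace u'≢brace IHt IHu P Q
    with Πb-app-inv P u≢brace | Πb-app-inv Q u'≢brace | x ∈? fvs t
  ... | f₁ , f₂ , P₁ , P₂ , f≡ | h₁ , h₂ , Q₁ , Q₂ , h≡ | yes x∈t rewrite f≡ N | h≡ N =
    +-excess (f₁ N) (f₂ N) (g N) (IHt P₁ Q₁)
      (≤-reflexive (Πb-functional (subst (λ v → Πb v h₂) ([≔]-fresh x s u (d x x∈t)) Q₂) P₂ N))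
  ... | f₁ , f₂ , P₁ , P₂ , f≡ | h₁ , h₂ , Q₁ , Q₂ , h≡ | no x∉t rewrite f≡ N | h≡ N =
    subst (h₁ N + h₂ N ≤_) (sym (+-assoc (f₁ N) (f₂ N) (g N)))
      (+-mono-≤ (≤-reflexive (Πb-functional (subst (λ v → Πb v h₁) ([≔]-fresh x s t x∉t) Q₁) P₁ N))
                (IHu P₂ Q₂))

  pair-excess : ∀ {t u} → Excess t → Excess u → Excess (pair t u)
  pair-excess IHt IHu (πpair {f = f₁} {f₂} P₁ P₂) (πpair Q₁ Q₂) =
    ⊔-excess (f₁ N) (f₂ N) (g N) (IHt P₁ Q₁) (IHu P₂ Q₂)

  const-excess : ∀ {c} → Excess (con c)
  const-excess πconst πconst = z≤n

  lam-excess : ∀ {τ b} L → (∀ n → (n , τ) ∉ L → Disjoint (fvs (openAt 0 (fvar (n , τ)) b)) (fvs s) →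
    Excess (openAt 0 (fvar (n , τ)) b)) → Disjoint (fvs b) (fvs s) → Excess (lam τ b)
  lam-excess {τ} {b} L IH d {h = h} P Q =
    IH k (k∉ ∘ there ∘ ∈-++⁺ˡ)
      (Disjoint-openAt-var 0 b (k∉ ∘ there ∘ ∈-++⁺ʳ L ∘ ∈-++⁺ʳ (fvs b) ∘ ∈-++⁺ˡ) d)
      (Πb-lam-inv P k (k∉ ∘ there ∘ ∈-++⁺ʳ L ∘ ∈-++⁺ˡ))
      (subst (λ v → Πb v h) (sym ([≔]-openAt-var x s 0 (k , τ) b (⦂⇒LocallyClosed Ds) (k∉ ∘ here)))
        (Πb-lam-inv Q k (k∉ ∘ there ∘ ∈-++⁺ʳ L ∘ ∈-++⁺ʳ (fvs b) ∘ ∈-++⁺ʳ (fvs s))))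
    where
      avoid = x ∷ L ++ fvs b ++ fvs s ++ fvs (b [ x ≔ s ])
      k = fresh avoid
      k∉ = fresh-∉ avoid τ

  lam₂-excess : ∀ {τ ρ r} L →
    (∀ n m → (n , τ) ∉ L → (m , ρ) ∉ L → (n , τ) ≢ (m , ρ) →
      Disjoint (fvs (open₂ (n , τ) (m , ρ) r)) (fvs s) → Excess (open₂ (n , τ) (m , ρ) r)) →
    Disjoint (fvs r) (fvs s) → Excess (lam τ (lam ρ r))
  lam₂-excess {τ} {ρ} {r} L IH d {h = h} P Q =
    IH n m (n∉ ∘ there ∘ ∈-++⁺ˡ) (m∉ ∘ there ∘ ∈-++⁺ˡ) n≢m
      (Disjoint-open₂ r (∉s n∉) (∉s m∉) d)
      (Πb-lam₂-inv P n m (∉r n∉) (∉r m∉) n≢m)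
      (subst (λ v → Πb v h)
         (sym ([≔]-open₂ x s (n , τ) (m , ρ) r (⦂⇒LocallyClosed Ds) (n∉ ∘ here) (m∉ ∘ here)))
        (Πb-lam₂-inv Q n m (∉s[≔]r n∉) (∉s[≔]r m∉) n≢m))
    where
      avoid = x ∷ L ++ fvs r ++ fvs s ++ fvs (r [ x ≔ s ])
      open Fresh₂ (fresh₂ avoid τ ρ)
      ∉r : ∀ {y} → y ∉ avoid → y ∉ fvs r
      ∉r y∉ = y∉ ∘ there ∘ ∈-++⁺ʳ L ∘ ∈-++⁺ˡ
      ∉s : ∀ {y} → y ∉ avoid → y ∉ fvs s
      ∉s y∉ = y∉ ∘ there ∘ ∈-++⁺ʳ L ∘ ∈-++⁺ʳ (fvs r) ∘ ∈-++⁺ˡ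
      ∉s[≔]r : ∀ {y} → y ∉ avoid → y ∉ fvs (r [ x ≔ s ])
      ∉s[≔]r y∉ = y∉ ∘ there ∘ ∈-++⁺ʳ L ∘ ∈-++⁺ʳ (fvs r) ∘ ∈-++⁺ʳ (fvs s)

  fold-excess : ∀ {t u} → Disjoint (fvs t) (fvs s) → fvs u ≡ [] → Excess t → Excess (app t (brace u))
  fold-excess {t} {u} dt e IH {f} {h} P Q =
    go P (subst (λ v → Πb (app (t [ x ≔ s ]) (brace v)) h) ([≔]-fresh x s u (∉-≡[] e)) Q)
    where
      go : Πb (app t (brace u)) f → Πb (app (t [ x ≔ s ]) (brace u)) h → h N ≤ f N + g N
      go (πappL {f = f₁} {g₁} (_ , il) P₁ Pu) (πappL {n = n} {h₁} (_ , il') Q₁ Qu)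
        with IsListOf-length-unique (IsListOf-[≔] x s il Ds dt) il'
      ... | refl = +-excess (f₁ N + (n ⊓ N) * g₁ N) ((n ⊓ N) * size u) (g N)
                     (+-excess (f₁ N) ((n ⊓ N) * g₁ N) (g N) (IH P₁ Q₁)
                        (≤-reflexive (cong ((n ⊓ N) *_) (Πb-functional Qu Pu N))))
                     ≤-refl
      go (πappL {n = n} (_ , il) _ _) (πapp ¬list _ _) =
        ⊥-elim (¬list (n , u , (_ , IsListOf-[≔] x s il Ds dt) , refl))
      go (πapp {f = f₁} _ P₁ (πbrace {g = g₁} Pu)) (πappL {n = n} {h₁} {g₂} _ Q₁ Qu) =
        subst (_≤ (f₁ N + (N * g₁ N + N * size u)) + g N) (sym (+-assoc (h₁ N) _ _))
          (+-excess (f₁ N) (N * g₁ N + N * size u) (g N) (IH P₁ Q₁)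
            (≤-trans (≤-reflexive (cong (λ k → (n ⊓ N) * k + (n ⊓ N) * size u) (Πb-functional Qu Pu N)))
                     (X-factor≤X n N (g₁ N) (size u))))
      go (πapp {f = f₁} _ P₁ (πbrace {g = g₁} Pu)) (πapp _ Q₁ (πbrace Qu)) =
        +-excess (f₁ N) (N * g₁ N + N * size u) (g N) (IH P₁ Q₁)
          (≤-reflexive (cong (λ k → N * k + N * size u) (Πb-functional Qu Pu N)))

  excess : ∀ {t σ} → t ⦂ σ → Disjoint (fvs t) (fvs s) → Excess t
  excess (⦂var {y}) d πvar Q with y ≟ᵥ x
  ... | yes refl = ≤-reflexive (Πb-functional Q Pg N)
  excess (⦂var {y}) d πvar πvar | no _ = z≤n
  excess ⦂con d = const-excess
  excess (⦂lam L f) d = lam-excess L (λ n n∉ → excess (f n n∉)) d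
  excess (⦂app {t} D E d) ds =
    app-excess d (λ _ → ⦂⇒≢brace E)
      (λ _ → ⦂⇒≢brace (⦂-[≔] x s E Ds (Disjoint-mono (∈-++⁺ʳ (fvs t)) id ds)))
      (excess D (Disjoint-mono ∈-++⁺ˡ id ds)) (excess E (Disjoint-mono (∈-++⁺ʳ (fvs t)) id ds))
  excess (⦂pair {t} D E) ds =
    pair-excess (excess D (Disjoint-mono ∈-++⁺ˡ id ds)) (excess E (Disjoint-mono (∈-++⁺ʳ (fvs t)) id ds))
  excess (⦂fst D) ds =
    app-excess (λ _ _ ()) (λ _ ()) (λ _ ()) (excess D (Disjoint-mono ∈-++⁺ˡ id ds)) const-excess
  excess (⦂snd D) ds =
    app-excess (λ _ _ ()) (λ _ ()) (λ _ ()) (excess D (Disjoint-mono ∈-++⁺ˡ id ds)) const-excess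
  excess (⦂if {t} {u} D E F d) ds =
    app-excess d (λ _ ()) (λ _ ()) (excess D (Disjoint-mono ∈-++⁺ˡ id ds))
      (pair-excess (excess E (Disjoint-mono (∈-++⁺ʳ (fvs t) ∘ ∈-++⁺ˡ) id ds))
                   (excess F (Disjoint-mono (∈-++⁺ʳ (fvs t) ∘ ∈-++⁺ʳ (fvs u)) id ds)))
  excess (⦂let⊗ {t} D L f d) ds =
    app-excess d (λ _ ()) (λ _ ()) (excess D (Disjoint-mono ∈-++⁺ˡ id ds))
      (lam₂-excess L (λ n m n∉ m∉ n≢m → excess (f n m n∉ m∉ n≢m))
         (Disjoint-mono (∈-++⁺ʳ (fvs t)) id ds))
  excess (⦂fold D E e) ds =
    fold-excess (Disjoint-mono ∈-++⁺ˡ id ds) e (excess D (Disjoint-mono ∈-++⁺ˡ id ds))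

-- In this model ◇ is empty, so nil is the only list and lists can be interpreted by ⊤.

⟦_⟧ : Ty → Set
⟦ ◇ ⟧      = ⊥
⟦ 𝐁 ⟧      = Bool
⟦ α ⊸ ρ ⟧  = ⟦ α ⟧ → ⟦ ρ ⟧
⟦ α ⊗ ρ ⟧  = ⟦ α ⟧ × ⟦ ρ ⟧
⟦ α ×ₜ ρ ⟧ = ⟦ α ⟧ × ⟦ ρ ⟧
⟦ 𝐋 α ⟧    = ⊤

⟦_⟧ᶜ : (c : Const) → ⟦ ctype c ⟧
⟦ tt ⟧ᶜ       = true
⟦ ff ⟧ᶜ       = false
⟦ nil τ ⟧ᶜ    = unit
⟦ cons τ ⟧ᶜ   = λ _ _ _ → unit
⟦ tens τ ρ ⟧ᶜ = _,_

Env : Term → Set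
Env t = ∀ {x} → x ∈ fvs t → ⟦ vtype x ⟧

eval : ∀ {t σ} → t ⦂ σ → Env t → ⟦ σ ⟧
eval (⦂var {x}) env = env (here refl)
eval (⦂con {c}) env = ⟦ c ⟧ᶜ
eval (⦂lam {τ} {b = b} L f) env v = eval (f n (n∉ ∘ ∈-++⁺ˡ)) env'
  where
    n = fresh (L ++ fvs b)
    n∉ = fresh-∉ (L ++ fvs b) τ
    env' : Env (openAt 0 (fvar (n , τ)) b)
    env' p with fvs-openAt⁻ 0 (fvar (n , τ)) b p
    ... | here refl = v
    ... | there q   = env q
eval (⦂app {t} D E _) env = eval D (env ∘ ∈-++⁺ˡ) (eval E (env ∘ ∈-++⁺ʳ (fvs t)))
eval (⦂pair {t} D E) env = eval D (env ∘ ∈-++⁺ˡ) , eval E (env ∘ ∈-++⁺ʳ (fvs t))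
eval (⦂fst D) env = proj₁ (eval D (env ∘ ∈-++⁺ˡ))
eval (⦂snd D) env = proj₂ (eval D (env ∘ ∈-++⁺ˡ))
eval (⦂if {t} {s} D E F _) env =
  if eval D (env ∘ ∈-++⁺ˡ)
  then eval E (env ∘ ∈-++⁺ʳ (fvs t) ∘ ∈-++⁺ˡ)
  else eval F (env ∘ ∈-++⁺ʳ (fvs t) ∘ ∈-++⁺ʳ (fvs s))
eval (⦂let⊗ {t} {r} {τ} {ρ} D L f _) env = eval (f n m (n∉ ∘ ∈-++⁺ˡ) (m∉ ∘ ∈-++⁺ˡ) n≢m) env'
  where
    open Fresh₂ (fresh₂ (L ++ fvs r) τ ρ)
    env' : Env (open₂ (n , τ) (m , ρ) r)
    env' p with fvs-open₂⁻ (n , τ) (m , ρ) r p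
    ... | here refl         = proj₁ (eval D (env ∘ ∈-++⁺ˡ))
    ... | there (here refl) = proj₂ (eval D (env ∘ ∈-++⁺ˡ))
    ... | there (there q)   = env (∈-++⁺ʳ (fvs t) q)
eval (⦂fold _ _ _) env = id

◇-has-free-var : ∀ {d} → d ⦂ ◇ → ∃ (_∈ fvs d)
◇-has-free-var {d} D with fvs d in eq
... | []    = ⊥-elim (eval D (λ p → ⊥-elim (∉-≡[] eq p)))
... | y ∷ _ = y , here refl

IsListOf⇒distinct-fvs : ∀ {τ n ℓ σ} → IsListOf τ n ℓ → ℓ ⦂ σ →
  ∃[ xs ] (Unique xs × xs ⊆ fvs ℓ × length xs ≡ n)
IsListOf⇒distinct-fvs lnil _ = [] , [] , (λ ()) , refl
IsListOf⇒distinct-fvs (lcons {d = d} {a} _ _ il) D with cons-app₃-inv D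
... | refl , Dd , _ , Dℓ , _ , daℓ with ◇-has-free-var Dd | IsListOf⇒distinct-fvs il Dℓ
...   | y , y∈d | xs , u , xs⊆ℓ , len =
  y ∷ xs , ¬Any⇒All¬ xs (daℓ y (∈-++⁺ˡ y∈d) ∘ xs⊆ℓ) ∷ u ,
  ⊆.∈-∷⁺ʳ (∈-++⁺ˡ (∈-++⁺ˡ y∈d)) (∈-++⁺ʳ (fvs d ++ fvs a) ∘ xs⊆ℓ) , cong suc len

IsListOf-length≤∣FV∣ : ∀ {τ n ℓ σ} → IsListOf τ n ℓ → ℓ ⦂ σ → n ≤ ∣FV∣ ℓ
IsListOf-length≤∣FV∣ {ℓ = ℓ} il D with IsListOf⇒distinct-fvs il D
... | xs , u , xs⊆ , refl = Unique⊆fvs⇒≤∣FV∣ ℓ u xs⊆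

Decreases : ℕ → Term → Term → Set
Decreases N t t' = ∀ {f f'} → Πb t f → Πb t' f' → f' N + size t' < f N + size t

<-+-suc : ∀ {a b c d} → a ≤ c → b ≤ d → a + b < c + suc d
<-+-suc {c = c} {d} a≤c b≤d = ≤-trans (s≤s (+-mono-≤ a≤c b≤d)) (≤-reflexive (sym (+-suc c d)))

πapp′ : ∀ {t s f g} → (∀ h → s ≢ brace h) → Πb t f → Πb s g → Πb (app t s) (λ N → f N + g N)
πapp′ s≢brace = πapp λ { (_ , h , _ , s≡) → s≢brace h s≡ }

β-decreases : ∀ {τ b s σ} N → app (lam τ b) s ⦂ σ → Decreases N (app (lam τ b) s) (openAt 0 s b)
β-decreases {b = b} {s} N (⦂app (⦂lam L f) Ds d) {f' = f'} P Q with Πb-app-inv P (λ _ → ⦂⇒≢brace Ds)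
... | _ , _ , Pλ , Ps , f≡ rewrite f≡ N =
  <-+-suc (Πb-[≔].excess N x s Ds Ps body⦂ body-disjoint (Πb-lam-inv Pλ _ x∉b)
                                                          (subst (λ v → Πb v f') (sym as-[≔]) Q))
          size-result
  where open βContractum b L f Ds d

π₁-decreases : ∀ {a b} N → Decreases N (app (pair a b) (con tt)) a
π₁-decreases {a} {b} N (πapp _ (πpair {f = fa} {fb} Pa Pb) πconst) Q =
  <-+-suc (≤-trans (≤-reflexive (Πb-functional Q Pa N)) (≤-trans (m≤m⊔n (fa N) (fb N)) (m≤m+n _ 0)))
          (≤-trans (m≤m⊔n (size a) (size b)) (m≤m+n _ 1))

π₂-decreases : ∀ {a b} N → Decreases N (app (pair a b) (con ff)) b
π₂-decreases {a} {b} N (πapp _ (πpair {f = fa} {fb} Pa Pb) πconst) Q =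
  <-+-suc (≤-trans (≤-reflexive (Πb-functional Q Pb N)) (≤-trans (m≤n⊔m (fa N) (fb N)) (m≤m+n _ 0)))
          (≤-trans (m≤n⊔m (size a) (size b)) (m≤m+n _ 1))

if-tt-decreases : ∀ {a b} N → Decreases N (app (con tt) (pair a b)) a
if-tt-decreases {a} {b} N (πapp _ πconst (πpair {f = fa} {fb} Pa Pb)) Q =
  <-+-suc (≤-trans (≤-reflexive (Πb-functional Q Pa N)) (m≤m⊔n (fa N) (fb N)))
          (≤-trans (m≤m⊔n (size a) (size b)) (n≤1+n _))

if-ff-decreases : ∀ {a b} N → Decreases N (app (con ff) (pair a b)) b
if-ff-decreases {a} {b} N (πapp _ πconst (πpair {f = fa} {fb} Pa Pb)) Q =
  <-+-suc (≤-trans (≤-reflexive (Πb-functional Q Pb N)) (m≤n⊔m (fa N) (fb N)))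
          (≤-trans (m≤n⊔m (size a) (size b)) (n≤1+n _))

⊗-weight-identity : ∀ ft fs fU t s r →
  3 + (((fU + fs) + ft) + ((r + s) + t)) ≡ (((0 + ft) + fs) + fU) + (((1 + t) + s) + suc (suc r))
⊗-weight-identity = solve-∀

⊗-decreases : ∀ {τ ρ t s r σ} N → app (app (app (con (tens τ ρ)) t) s) (lam τ (lam ρ r)) ⦂ σ →
  Decreases N (app (app (app (con (tens τ ρ)) t) s) (lam τ (lam ρ r))) (openAt 1 t (openAt 0 s r))
⊗-decreases N (⦂app D _ _) _ _ with tens-app₂-inv D
... | () , _
⊗-decreases {τ} {ρ} {t} {s} {r} N (⦂let⊗ D L f d) {fᵣ} {f'} P Q with tens-app₂-inv D
... | refl , Dt , Ds , dts with Πb-app-inv P (λ _ ())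
...   | fA , fU , PA , PU , fᵣ≡ = begin-strict
  f' N + size (openAt 1 t (openAt 0 s r))              ≤⟨ +-mono-≤ π-bound size-result ⟩
  ((fU N + fs N) + ft N) + ((size r + size s) + size t) <⟨ m≤n+m _ 2 ⟩
  3 + (((fU N + fs N) + ft N) + ((size r + size s) + size t))
    ≡⟨ ⊗-weight-identity (ft N) (fs N) (fU N) (size t) (size s) (size r) ⟩
  (((0 + ft N) + fs N) + fU N) + size redex            ≡⟨ cong (λ k → (k + fU N) + size redex) (sym fA≡) ⟩
  (fA N + fU N) + size redex                           ≡⟨ cong (_+ size redex) (sym (fᵣ≡ N)) ⟩
  fᵣ N + size redex                                     ∎
  where
    open ≤-Reasoning
    open ⊗Contractum r Dt Ds L f dts d
    redex = app (app (app (con (tens τ ρ)) t) s) (lam τ (lam ρ r))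
    ft = proj₁ (Πb-exists Dt)
    fs = proj₁ (Πb-exists Ds)
    Pt = proj₂ (Πb-exists Dt)
    Ps = proj₂ (Πb-exists Ds)
    fA≡ : fA N ≡ (0 + ft N) + fs N
    fA≡ = Πb-functional PA
            (πapp′ (λ _ → ⦂⇒≢brace Ds) (πapp′ (λ _ → ⦂⇒≢brace Dt) πconst Pt) Ps) N
    Pbody' = proj₂ (Πb-exists body'⦂)
    π-bound : f' N ≤ (fU N + fs N) + ft N
    π-bound = ≤-trans
      (Πb-[≔].excess N x t Dt Pt body'⦂ body'-disjoint Pbody' (subst (λ v → Πb v f') (sym as-[≔]) Q))
      (+-monoˡ-≤ (ft N)
        (Πb-[≔].excess N y s Ds Ps body⦂ body-disjoint (Πb-lam₂-inv PU n m x∉r y∉r n≢m) Pbody'))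

nil-decreases : ∀ {τ t s σ} N → app (app (con (nil τ)) (brace t)) s ⦂ σ →
  Decreases N (app (app (con (nil τ)) (brace t)) s) s
nil-decreases {τ} {t} {s} N D P Q with fold-app-inv D
... | _ , _ , _ , _ , Ds , _ with Πb-app-inv P (λ _ → ⦂⇒≢brace Ds)
...   | fA , fs , PA , Ps , f≡ rewrite f≡ N =
  <-+-suc (≤-trans (≤-reflexive (Πb-functional Q Ps N)) (m≤n+m (fs N) (fA N))) ≤-refl

cons-weight-identity : ∀ n gt t fd fa fℓ fs d a ℓ s →
  1 + ((((gt + fd) + fa) + ((fℓ + n * gt + n * t) + fs)) + (((t + d) + a) + ((ℓ + 0) + s)))
  ≡ ((((((0 + fd) + fa) + fℓ) + suc n * gt + suc n * t) + fs) + (((((1 + d) + a) + ℓ) + 0) + s))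
cons-weight-identity = solve-∀

-- With n + 1 ≤ N the factor X_{n+1}(N) in the redex exceeds the factor X_n(N) in the
-- contractum by one; this pays for the unfolded copy of the folded function.
cons-weight-drop : ∀ N n gt t fd fa fℓ fs d a ℓ s → suc n ≤ N →
  (((gt + fd) + fa) + ((fℓ + (n ⊓ N) * gt + (n ⊓ N) * t) + fs)) + (((t + d) + a) + ((ℓ + 0) + s))
  < ((((((0 + fd) + fa) + fℓ) + (suc n ⊓ N) * gt + (suc n ⊓ N) * t) + fs) + (((((1 + d) + a) + ℓ) + 0) + s))
cons-weight-drop N n gt t fd fa fℓ fs d a ℓ s n<N
  rewrite m≤n⇒m⊓n≡m n<N | m≤n⇒m⊓n≡m (≤-trans (n≤1+n n) n<N) =
  ≤-reflexive (cons-weight-identity n gt t fd fa fℓ fs d a ℓ s)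

cons-decreases : ∀ {τ d a ℓ t s n σ} N → IsList n ℓ →
  let redex = app (app (app (app (app (con (cons τ)) d) a) ℓ) (brace t)) s in
  ∣FV∣ redex ≤ N → redex ⦂ σ →
  Decreases N redex (app (app (app t d) a) (app (app ℓ (brace t)) s))
cons-decreases {τ} {d} {a} {ℓ} {t} {s} {n} N (_ , il) fv≤N D {f} {f'} P Q with fold-app-inv D
... | _ , Dcons , Dt , _ , Ds , _ with cons-app₃-inv Dcons
...   | refl , Dd , Da , Dℓ , _ with IsListOf-type Dℓ il
...     | refl =
  subst₂ (λ p q → p + _ < q + _) (sym (Πb-functional Q contractum-π N)) (sym (Πb-functional P redex-π N))
    (cons-weight-drop N n (gt N) (size t) (fd N) (fa N) (fℓ N) (fs N)
                          (size d) (size a) (size ℓ) (size s) entries≤N)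
  where
    fd = proj₁ (Πb-exists Dd)
    fa = proj₁ (Πb-exists Da)
    fℓ = proj₁ (Πb-exists Dℓ)
    gt = proj₁ (Πb-exists Dt)
    fs = proj₁ (Πb-exists Ds)
    Pd = proj₂ (Πb-exists Dd)
    Pa = proj₂ (Πb-exists Da)
    Pℓ = proj₂ (Πb-exists Dℓ)
    Pt = proj₂ (Πb-exists Dt)
    Ps = proj₂ (Πb-exists Ds)
    consL = app (app (app (con (cons τ)) d) a) ℓ
    consℓ = lcons (⦂⇒Typable Dd) (⦂⇒Typable Da) il
    entries≤N : suc n ≤ N
    entries≤N = ≤-trans (IsListOf-length≤∣FV∣ consℓ Dcons)
                  (≤-trans (∣FV∣-mono consL (app (app consL (brace t)) s) (∈-++⁺ˡ ∘ ∈-++⁺ˡ)) fv≤N)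
    typed : ∀ {u α} → u ⦂ α → ∀ h → u ≢ brace h
    typed Du _ = ⦂⇒≢brace Du
    redex-π = πapp′ (typed Ds)
      (πappL (_ , consℓ)
        (πapp′ (typed Dℓ) (πapp′ (typed Da) (πapp′ (typed Dd) πconst Pd) Pa) Pℓ) Pt) Ps
    contractum-π = πapp′ (λ _ ())
      (πapp′ (typed Da) (πapp′ (typed Dd) Pt Pd) Pa) (πapp′ (typed Ds) (πappL (_ , il) Pℓ Pt) Ps)

↦-decreases : ∀ {t t' σ} N → t ↦ t' → t ⦂ σ → ∣FV∣ t ≤ N → Decreases N t t'
↦-decreases N β         D _    = β-decreases N D
↦-decreases N π₁        _ _    = π₁-decreases N
↦-decreases N π₂        _ _    = π₂-decreases N
↦-decreases N if-tt     _ _    = if-tt-decreases N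
↦-decreases N if-ff     _ _    = if-ff-decreases N
↦-decreases N ⊗-conv    D _    = ⊗-decreases N D
↦-decreases N nil-conv  D _    = nil-decreases N D
↦-decreases N (cons-conv il) D fv≤N = cons-decreases N il fv≤N D

weight-congˡ : ∀ h f a' a A' A c → h + a' < f + a → A' ≤ A → (h + A') + (a' + c) < (f + A) + (a + c)
weight-congˡ h f a' a A' A c h< A'≤ =
  subst₂ _<_ (interchange h a' A' c) (interchange f a A c) (+-mono-<-≤ h< (+-monoˡ-≤ c A'≤))

weight-congʳ : ∀ h f a' a b c → h + a' < f + a → (c + h) + (b + a') < (c + f) + (b + a)
weight-congʳ h f a' a b c h< =
  subst₂ _<_ (interchange c b h a') (interchange c b f a) (+-monoʳ-< (c + b) h<)

appˡ-decreases : ∀ {t t' s} N → (∀ {τ n} → IsListOf τ n t → IsListOf τ n t') →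
  Decreases N t t' → Decreases N (app t s) (app t' s)
appˡ-decreases {t} {t'} {s} N list-preserved IH = go
  where
    go : Decreases N (app t s) (app t' s)
    go (πapp {f = f₁} {g} _ P₁ P₂) (πapp {f = h₁} _ Q₁ Q₂) =
      weight-congˡ (h₁ N) (f₁ N) (size t') (size t) _ (g N) (size s) (IH P₁ Q₁)
        (≤-reflexive (Πb-functional Q₂ P₂ N))
    go (πappL {h = u} {n} {f₁} {g} (_ , il) P₁ Pu) (πappL {f = h₁} {g'} (_ , il') Q₁ Qu)
      with IsListOf-length-unique (list-preserved il) il'
    ... | refl =
      subst₂ (λ p q → p + (size t' + 0) < q + (size t + 0))
             (sym (+-assoc (h₁ N) _ _)) (sym (+-assoc (f₁ N) _ _))
        (weight-congˡ (h₁ N) (f₁ N) (size t') (size t) _ _ 0 (IH P₁ Q₁)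
          (≤-reflexive (cong (λ k → (n ⊓ N) * k + (n ⊓ N) * size u) (Πb-functional Qu Pu N))))
    go (πappL {h = u} {n} (_ , il) _ _) (πapp ¬list _ _) =
      ⊥-elim (¬list (n , u , (_ , list-preserved il) , refl))
    go (πapp {f = f₁} _ P₁ (πbrace {h = u} {g} Pu)) (πappL {n = n} {h₁} {g'} _ Q₁ Qu) =
      subst (λ p → p + (size t' + 0) < (f₁ N + (N * g N + N * size u)) + (size t + 0))
            (sym (+-assoc (h₁ N) _ _))
        (weight-congˡ (h₁ N) (f₁ N) (size t') (size t) _ _ 0 (IH P₁ Q₁)
          (≤-trans (≤-reflexive (cong (λ k → (n ⊓ N) * k + (n ⊓ N) * size u) (Πb-functional Qu Pu N)))
                   (X-factor≤X n N (g N) (size u))))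

appʳ-decreases : ∀ {t s s'} N → (∀ h → s ≢ brace h) → (∀ h → s' ≢ brace h) →
  Decreases N s s' → Decreases N (app t s) (app t s')
appʳ-decreases {t} {s} {s'} N s≢brace s'≢brace IH P Q with Πb-app-inv P s≢brace | Πb-app-inv Q s'≢brace
... | f₁ , f₂ , P₁ , P₂ , f≡ | h₁ , h₂ , Q₁ , Q₂ , h≡
  rewrite f≡ N | h≡ N | Πb-functional Q₁ P₁ N =
  weight-congʳ (h₂ N) (f₂ N) (size s') (size s) (size t) (f₁ N) (IH P₂ Q₂)

app-head-typed : ∀ {t s σ} → app t s ⦂ σ → ∃ (t ⦂_)
app-head-typed (⦂app D _ _)     = _ , D
app-head-typed (⦂fst D)         = _ , D
app-head-typed (⦂snd D)         = _ , D
app-head-typed (⦂if D _ _ _)    = _ , D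
app-head-typed (⦂let⊗ D _ _ _)  = _ , D
app-head-typed (⦂fold D _ _)    = _ , D

app-arg-typed : ∀ {t s s' σ} → app t s ⦂ σ → s ⟶ s' → ∃ (s ⦂_)
app-arg-typed (⦂app _ E _) _ = _ , E
app-arg-typed (⦂fst _)         (conv ())
app-arg-typed (⦂snd _)         (conv ())
app-arg-typed (⦂if _ _ _ _)    (conv ())
app-arg-typed (⦂let⊗ _ _ _ _)  (conv ())
app-arg-typed (⦂fold _ _ _)    (conv ())

⟶⇒≢brace : ∀ {s s' h} → s ⟶ s' → s ≢ brace h
⟶⇒≢brace (conv ()) refl

⟶-decreases : ∀ {t t' σ} N → t ⦂ σ → ∣FV∣ t ≤ N → t ⟶ t' → Decreases N t t'
⟶-decreases N D fv≤N (conv c) = ↦-decreases N c D fv≤N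
⟶-decreases N D fv≤N (appˡ {t} {s = s} r) =
  appˡ-decreases N (λ il → IsListOf-⟶ il r)
    (⟶-decreases N (proj₂ (app-head-typed D)) (≤-trans (∣FV∣-mono t (app t s) ∈-++⁺ˡ) fv≤N) r)
⟶-decreases N D fv≤N (appʳ {t} {s} r) with app-arg-typed D r
... | _ , Ds = appʳ-decreases N (λ _ → ⟶⇒≢brace r) (λ _ → ⦂⇒≢brace (⦂-⟶ r Ds))
                 (⟶-decreases N Ds (≤-trans (∣FV∣-mono s (app t s) (∈-++⁺ʳ (fvs t))) fv≤N) r)

Steps-length≤ : ∀ {k t t' σ f} N → t ⦂ σ → ∣FV∣ t ≤ N → Steps k t t' → Πb t f →
  k ≤ f N + size t
Steps-length≤ N D fv≤N done P = z≤n
Steps-length≤ {t = t} N D fv≤N (step {u = u} r st) P =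
  ≤-trans (s≤s (Steps-length≤ N Du (≤-trans (∣FV∣-mono u t (fvs-⟶ r)) fv≤N) st (proj₂ (Πb-exists Du))))
          (⟶-decreases N D fv≤N r P (proj₂ (Πb-exists Du)))
  where Du = ⦂-⟶ r D

theorem4p8 : ∀ {Γ t τ} → Γ ⊢ t ∶ τ →
    (∀ (N : ℕ) t' f f' → ∣FV∣ t ≤ N → t ⟶ t' → Πb t f → Πb t' f' →
       f' N + size t' < f N + size t)
    × (∀ (k : ℕ) t' f → Steps k t t' → Πb t f → k ≤ f (∣FV∣ t) + size t)
theorem4p8 {t = t} D =
  (λ N t' f f' fv≤N r → ⟶-decreases N (⊢⇒⦂ D) fv≤N r) ,
  (λ k t' f st → Steps-length≤ (∣FV∣ t) (⊢⇒⦂ D) ≤-refl st)
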